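{- Let $t_1$ and $t_2$ be hereditarily defined terms. If $\bar t_1\equiv_{\lambda_C}\bar t_2$, then $t_1\equiv_{\lambda_C}t_2$.
   Context: The lambda calculus with constructors ($\lambda_C$). Fix constructors $\{c_1,\dots,c_n\}$ ($n\ge1$). Terms: $t,u::=x\mid tu\mid\lambda x.t\mid c\mid\{\theta\}\cdot t$, case-bindings $\theta=\{d_1\mapsto u_1;\dots;d_k\mapsto u_k\}$ ($k\ge0$, pairwise distinct constructors), $\mathrm{dom}(\theta)=\{d_1,\dots,d_k\}$; terms up to $\alpha$-conversion. $\theta\circ\{d_j\mapsto t_j\}_j=\{d_j\mapsto\{\theta\}\cdot t_j\}_j$. One-step reduction $\to$ is the contextual closure of: (AppLam) $(\lambda x.t)u\to t[x:=u]$; (LamApp) $\lambda x.t\,x\to t$ if $x\notin FV(t)$; (CaseCons) $\{\theta\}\cdot c\to t$ if $(c\mapsto t)\in\theta$; (CaseApp) $\{\theta\}\cdot(tu)\to(\{\theta\}\cdot t)u$; (CaseLam) $\{\theta\}\cdot\lambda x.t\to\lambda x.\{\theta\}\cdot t$ if $x\notin FV(\theta)$; (CaseCase) $\{\theta\}\cdot\{\phi\}\cdot t\to\{\theta\circ\phi\}\cdot t$. $\equiv_{\lambda_C}$ is its reflexive symmetric transitive closure. A match failure is $\{\theta\}\cdot c$ with $c\notin\mathrm{dom}(\theta)$; a term is defined if no subterm is a match failure, and hereditarily defined if all its reducts (zero or more steps) are defined. Case-completion: $\bar x=x$, $\bar c=c$, $\overline{\lambda x.t}=\lambda x.\bar t$,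 $\overline{tu}=\bar t\,\bar u$, $\overline{\{\theta\}\cdot t}=\{\bar\theta\}\cdot\bar t$, where $\bar\theta=\{c_i\mapsto u'_i\mid 1\le i\le n\}$ with $u'_i=\bar u_i$ if $(c_i\mapsto u_i)\in\theta$ and $u'_i=\{\}\cdot c_1$ (the empty case-binding applied to $c_1$) if $c_i\notin\mathrm{dom}(\theta)$. -}

module Defs where

-- Terms are represented with de Bruijn indices (this realises "terms up to
-- alpha-conversion").  Constructors are the elements of Fin n; the theorem is
-- stated for n = suc m (so n ≥ 1) and c_1 is Fin.zero.
-- A case-binding is a table with one optional entry per constructor: entry
-- i is (just u) iff (c_i ↦ u) ∈ θ.  This realises finite case-bindings with
-- pairwise distinct constructors, taken as sets.

open import Data.Nat using (ℕ; zero; suc)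
open import Data.Fin using (Fin; zero; suc)
open import Data.Maybe using (Maybe; just; nothing)
open import Relation.Binary.PropositionalEquality using (_≡_)
open import Relation.Nullary using (¬_)
open import Relation.Binary.Construct.Closure.ReflexiveTransitive using (Star)
open import Relation.Binary.Construct.Closure.Equivalence using (EqClosure)

mutual
  data Term (n : ℕ) : Set where
    var  : ℕ → Term n
    app  : Term n → Term n → Term n
    lam  : Term n → Term n
    con  : Fin n → Term n
    case : Cases n n → Term n → Term n

  data Cases (n : ℕ) : ℕ → Set where
    []  : Cases n zero
    _∷_ : ∀ {k} → Maybe (Term n) → Cases n k → Cases n (suc k)

infixr 5 _∷_

private
  variable
    n k : ℕ

lookupC : Cases n k → Fin k → Maybe (Term n)
lookupC (m ∷ θ) zero    = m
lookupC (m ∷ θ) (suc i) = lookupC θ i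

emptyC : ∀ {n} k → Cases n k
emptyC zero    = []
emptyC (suc k) = nothing ∷ emptyC k

ext : (ℕ → ℕ) → ℕ → ℕ
ext ρ zero    = zero
ext ρ (suc x) = suc (ρ x)

mutual
  ren : (ℕ → ℕ) → Term n → Term n
  ren ρ (var x)    = var (ρ x)
  ren ρ (app t u)  = app (ren ρ t) (ren ρ u)
  ren ρ (lam t)    = lam (ren (ext ρ) t)
  ren ρ (con c)    = con c
  ren ρ (case θ t) = case (renC ρ θ) (ren ρ t)

  renC : (ℕ → ℕ) → Cases n k → Cases n k
  renC ρ []             = []
  renC ρ (nothing ∷ θ)  = nothing ∷ renC ρ θ
  renC ρ (just t ∷ θ)   = just (ren ρ t) ∷ renC ρ θ

weaken : Term n → Term n
weaken = ren suc

weakenC : Cases n k → Cases n k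
weakenC = renC suc

exts : (ℕ → Term n) → ℕ → Term n
exts σ zero    = var zero
exts σ (suc x) = weaken (σ x)

mutual
  sub : (ℕ → Term n) → Term n → Term n
  sub σ (var x)    = σ x
  sub σ (app t u)  = app (sub σ t) (sub σ u)
  sub σ (lam t)    = lam (sub (exts σ) t)
  sub σ (con c)    = con c
  sub σ (case θ t) = case (subC σ θ) (sub σ t)

  subC : (ℕ → Term n) → Cases n k → Cases n k
  subC σ []            = []
  subC σ (nothing ∷ θ) = nothing ∷ subC σ θ
  subC σ (just t ∷ θ)  = just (sub σ t) ∷ subC σ θ

single : Term n → ℕ → Term n
single u zero    = u
single u (suc x) = var x

_[_] : Term n → Term n → Term n
t [ u ] = sub (single u) t

compC : Cases n n → Cases n k → Cases n k
compC θ []            = []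
compC θ (nothing ∷ φ) = nothing ∷ compC θ φ
compC θ (just u ∷ φ)  = just (case θ u) ∷ compC θ φ

infix 4 _⟶_ _⟶C_

mutual
  data _⟶_ {n : ℕ} : Term n → Term n → Set where
    AppLam   : ∀ {t u} → app (lam t) u ⟶ t [ u ]
    -- λx. t x → t  with x ∉ FV(t): t is a weakened term
    LamApp   : ∀ {t} → lam (app (weaken t) (var zero)) ⟶ t
    CaseCons : ∀ {θ c t} → lookupC θ c ≡ just t → case θ (con c) ⟶ t
    CaseApp  : ∀ {θ t u} → case θ (app t u) ⟶ app (case θ t) u
    -- x ∉ FV(θ) handled by shifting θ under the binder
    CaseLam  : ∀ {θ t} → case θ (lam t) ⟶ lam (case (weakenC θ) t)
    CaseCase : ∀ {θ φ t} → case θ (case φ t) ⟶ case (compC θ φ) t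
    appL     : ∀ {t t' u} → t ⟶ t' → app t u ⟶ app t' u
    appR     : ∀ {t u u'} → u ⟶ u' → app t u ⟶ app t u'
    lamC     : ∀ {t t'} → t ⟶ t' → lam t ⟶ lam t'
    caseBody : ∀ {θ t t'} → t ⟶ t' → case θ t ⟶ case θ t'
    caseBr   : ∀ {θ θ' t} → θ ⟶C θ' → case θ t ⟶ case θ' t

  data _⟶C_ {n : ℕ} : ∀ {k} → Cases n k → Cases n k → Set where
    here  : ∀ {k t t'} {θ : Cases n k} → t ⟶ t' → just t ∷ θ ⟶C just t' ∷ θ
    there : ∀ {k m} {θ θ' : Cases n k} → θ ⟶C θ' → m ∷ θ ⟶C m ∷ θ'

_≡λC_ : Term n → Term n → Set
_≡λC_ = EqClosure _⟶_

_⟶*_ : Term n → Term n → Set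
_⟶*_ = Star _⟶_

mutual
  data HasMatchFailure {n : ℕ} : Term n → Set where
    here     : ∀ {θ c} → lookupC θ c ≡ nothing → HasMatchFailure (case θ (con c))
    appL     : ∀ {t u} → HasMatchFailure t → HasMatchFailure (app t u)
    appR     : ∀ {t u} → HasMatchFailure u → HasMatchFailure (app t u)
    lamC     : ∀ {t} → HasMatchFailure t → HasMatchFailure (lam t)
    caseBody : ∀ {θ t} → HasMatchFailure t → HasMatchFailure (case θ t)
    caseBr   : ∀ {θ t} → HasMatchFailureC θ → HasMatchFailure (case θ t)

  data HasMatchFailureC {n : ℕ} : ∀ {k} → Cases n k → Set where
    here  : ∀ {k t} {θ : Cases n k} → HasMatchFailure t → HasMatchFailureC (just t ∷ θ)
    there : ∀ {k m} {θ : Cases n k} → HasMatchFailureC θ → HasMatchFailureC (m ∷ θ)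

Defined : Term n → Set
Defined t = ¬ HasMatchFailure t

HereditarilyDefined : Term n → Set
HereditarilyDefined t = ∀ u → t ⟶* u → Defined u

mutual
  complete : ∀ {m} → Term (suc m) → Term (suc m)
  complete (var x)    = var x
  complete (app t u)  = app (complete t) (complete u)
  complete (lam t)    = lam (complete t)
  complete (con c)    = con c
  complete (case θ t) = case (completeC θ) (complete t)

  completeC : ∀ {m k} → Cases (suc m) k → Cases (suc m) k
  completeC []            = []
  completeC {m} (nothing ∷ θ) = just (case (emptyC (suc m)) (con zero)) ∷ completeC θ
  completeC (just u ∷ θ)  = just (complete u) ∷ completeC θ

-- Completion only inserts branches {}·c₁, each a match failure.  Call u a
-- completion of s when u is s with some absent branches filled by such junk
-- (terms whose reducts always exhibit a match failure).  If s is defined, a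
-- step of u never selects a junk branch, so every reduction of u is mirrored
-- by a reduction of s preserving the relation; and two defined terms with a
-- common completion are equal.  Given t̄₁ ≡ t̄₂, confluence of λ_C yields a
-- common reduct w; mirroring gives reducts of t₁ and t₂, both defined by
-- hereditary definedness and both completed by w, hence equal.
--
-- Confluence is proved by a triangle argument.  The rules other than AppLam
-- are normalising, with normal form nf computed by η-contracting and pushing
-- case-bindings inwards; parallel β-steps commute with nf, so parallel
-- β-reduction between nf-normal forms has Takahashi's triangle property.

module Submission where

open import Defs
open import Data.Nat using (ℕ; zero; suc)
open import Data.Fin using (Fin; zero; suc)
open import Data.Maybe using (Maybe; just; nothing; map; zipWith; maybe′)
open import Function using (id; _∘_)
open import Data.Maybe.Properties using (map-nothing)
open import Data.Product using (∃; ∃₂; _×_; _,_)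
open import Data.Sum using (_⊎_; inj₁; inj₂)
open import Data.Empty using (⊥-elim)
open import Relation.Nullary using (¬_)
open import Relation.Binary.Core using (Rel)
open import Relation.Binary.PropositionalEquality using (_≡_; refl; sym; trans; cong; cong₂; subst; subst₂)
open import Relation.Binary.Construct.Closure.ReflexiveTransitive using (Star; ε; _◅_; _◅◅_; gmap; concat)
open import Relation.Binary.Construct.Closure.Symmetric using (fwd; bwd)
open import Relation.Binary.Construct.Closure.Equivalence using (EqClosure)
import Relation.Binary.Construct.Closure.Equivalence as EqClosure
open import Relation.Binary.Construct.Closure.Equivalence.Properties using (a—↠b⇒a↔b; a—↠b⇒b↔a)
open import Relation.Binary.Rewriting using (Confluent)

private
  variable
    n : ℕ

module _ {a ℓ} {A : Set a} {_▷_ : Rel A ℓ} where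

  triangle⇒confluent : (f : A → A) → (∀ {x y} → x ▷ y → y ▷ f x) → Confluent _▷_
  triangle⇒confluent f triangle = confluent
    where
    strip : ∀ {x y z} → x ▷ y → Star _▷_ x z → ∃ λ w → Star _▷_ y w × z ▷ w
    strip {y = y} x▷y ε = y , ε , x▷y
    strip x▷y (x▷x' ◅ x'▷*z) with strip (triangle x▷x') x'▷*z
    ... | w , fx▷*w , z▷w = w , triangle x▷y ◅ fx▷*w , z▷w

    confluent : Confluent _▷_
    confluent {C = z} ε x▷*z = z , x▷*z , ε
    confluent (x▷x' ◅ x'▷*y) x▷*z with strip x▷x' x▷*z
    ... | w₁ , x'▷*w₁ , z▷w₁ with confluent x'▷*y x'▷*w₁
    ...   | w , y▷*w , w₁▷*w = w , y▷*w , z▷w₁ ◅ w₁▷*w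

  confluent⇒churchRosser : Confluent _▷_ → ∀ {x y} → EqClosure _▷_ x y → ∃ λ w → Star _▷_ x w × Star _▷_ y w
  confluent⇒churchRosser conf {x} ε = x , ε , ε
  confluent⇒churchRosser conf (fwd x▷x' ◅ x'≈y) with confluent⇒churchRosser conf x'≈y
  ... | w , x'▷*w , y▷*w = w , x▷x' ◅ x'▷*w , y▷*w
  confluent⇒churchRosser conf (bwd x'▷x ◅ x'≈y) with confluent⇒churchRosser conf x'≈y
  ... | w , x'▷*w , y▷*w with conf (x'▷x ◅ ε) x'▷*w
  ...   | v , x▷*v , w▷*v = v , x▷*v , y▷*w ◅◅ w▷*v

zipWith-map : ∀ {A B C A' B' C' : Set} (f : A → B → C) (f' : A' → B' → C') (ga : A → A') (gb : B → B') (gc : C → C') →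
        (∀ a b → gc (f a b) ≡ f' (ga a) (gb b)) → ∀ ma mb → zipWith f' (map ga ma) (map gb mb) ≡ map gc (zipWith f ma mb)
zipWith-map f f' ga gb gc h (just a) (just b) = cong just (sym (h a b))
zipWith-map f f' ga gb gc h (just a) nothing = refl
zipWith-map f f' ga gb gc h nothing mb = refl

zipWith-just⁻¹ : ∀ {A B C : Set} (f : A → B → C) ma mb {c} → zipWith f ma mb ≡ just c → ∃₂ λ a b
    → ma ≡ just a × mb ≡ just b × c ≡ f a b
zipWith-just⁻¹ f (just a) (just b) refl = a , b , refl , refl , refl
zipWith-just⁻¹ f (just a) nothing ()
zipWith-just⁻¹ f nothing mb ()

map-just⁻¹ : ∀ {A B : Set} (f : A → B) ma {c} → map f ma ≡ just c → ∃ λ a → ma ≡ just a × c ≡ f a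
map-just⁻¹ f (just a) refl = a , refl , refl
map-just⁻¹ f nothing ()

map-map : ∀ {A B C B' : Set} (f : A → B) (g : B → C) (f' : A → B') (g' : B' → C)
    → (∀ a → g (f a) ≡ g' (f' a)) → ∀ ma → map g (map f ma) ≡ map g' (map f' ma)
map-map f g f' g' h (just a) = cong just (h a)
map-map f g f' g' h nothing = refl

map-nothing⁻¹ : ∀ {A B : Set} (f : A → B) (m : Maybe A) → map f m ≡ nothing → m ≡ nothing
map-nothing⁻¹ f nothing e = refl
map-nothing⁻¹ f (just x) ()

just∷ : ∀ {k} → Term n → Cases n k → Cases n (suc k)
just∷ a θ = just a ∷ θ

ext-cong : ∀ {ρ ρ' : ℕ → ℕ} → (∀ x → ρ x ≡ ρ' x) → ∀ x → ext ρ x ≡ ext ρ' x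
ext-cong h zero = refl
ext-cong h (suc x) = cong suc (h x)

mutual
  ren-cong : ∀ {ρ ρ'} → (∀ x → ρ x ≡ ρ' x) → (t : Term n) → ren ρ t ≡ ren ρ' t
  ren-cong h (var x) = cong var (h x)
  ren-cong h (app t u) = cong₂ app (ren-cong h t) (ren-cong h u)
  ren-cong h (lam t) = cong lam (ren-cong (ext-cong h) t)
  ren-cong h (con c) = refl
  ren-cong h (case θ t) = cong₂ case (renC-cong h θ) (ren-cong h t)

  renC-cong : ∀ {k ρ ρ'} → (∀ x → ρ x ≡ ρ' x) → (θ : Cases n k) → renC ρ θ ≡ renC ρ' θ
  renC-cong h [] = refl
  renC-cong h (nothing ∷ θ) = cong (nothing ∷_) (renC-cong h θ)
  renC-cong h (just t ∷ θ) = cong₂ just∷ (ren-cong h t) (renC-cong h θ)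

mutual
  ren-ren : ∀ ρ ρ' (t : Term n) → ren ρ (ren ρ' t) ≡ ren (λ x → ρ (ρ' x)) t
  ren-ren ρ ρ' (var x) = refl
  ren-ren ρ ρ' (app t u) = cong₂ app (ren-ren ρ ρ' t) (ren-ren ρ ρ' u)
  ren-ren ρ ρ' (lam t) = cong lam (trans (ren-ren (ext ρ) (ext ρ') t) (ren-cong (λ { zero → refl ; (suc x) → refl }) t))
  ren-ren ρ ρ' (con c) = refl
  ren-ren ρ ρ' (case θ t) = cong₂ case (renC-ren ρ ρ' θ) (ren-ren ρ ρ' t)

  renC-ren : ∀ {k} ρ ρ' (θ : Cases n k) → renC ρ (renC ρ' θ) ≡ renC (λ x → ρ (ρ' x)) θ
  renC-ren ρ ρ' [] = refl
  renC-ren ρ ρ' (nothing ∷ θ) = cong (nothing ∷_) (renC-ren ρ ρ' θ)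
  renC-ren ρ ρ' (just t ∷ θ) = cong₂ just∷ (ren-ren ρ ρ' t) (renC-ren ρ ρ' θ)

mutual
  sub-cong : ∀ {σ σ' : ℕ → Term n} → (∀ x → σ x ≡ σ' x) → (t : Term n) → sub σ t ≡ sub σ' t
  sub-cong h (var x) = h x
  sub-cong h (app t u) = cong₂ app (sub-cong h t) (sub-cong h u)
  sub-cong h (lam t) = cong lam (sub-cong (λ { zero → refl ; (suc x) → cong weaken (h x) }) t)
  sub-cong h (con c) = refl
  sub-cong h (case θ t) = cong₂ case (subC-cong h θ) (sub-cong h t)

  subC-cong : ∀ {k} {σ σ' : ℕ → Term n} → (∀ x → σ x ≡ σ' x) → (θ : Cases n k) → subC σ θ ≡ subC σ' θ
  subC-cong h [] = refl
  subC-cong h (nothing ∷ θ) = cong (nothing ∷_) (subC-cong h θ)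
  subC-cong h (just t ∷ θ) = cong₂ just∷ (sub-cong h t) (subC-cong h θ)

mutual
  sub-ren : ∀ (σ : ℕ → Term n) ρ (t : Term n) → sub σ (ren ρ t) ≡ sub (λ x → σ (ρ x)) t
  sub-ren σ ρ (var x) = refl
  sub-ren σ ρ (app t u) = cong₂ app (sub-ren σ ρ t) (sub-ren σ ρ u)
  sub-ren σ ρ (lam t) = cong lam (trans (sub-ren (exts σ) (ext ρ) t) (sub-cong (λ { zero → refl ; (suc x) → refl }) t))
  sub-ren σ ρ (con c) = refl
  sub-ren σ ρ (case θ t) = cong₂ case (subC-ren σ ρ θ) (sub-ren σ ρ t)

  subC-ren : ∀ {k} (σ : ℕ → Term n) ρ (θ : Cases n k) → subC σ (renC ρ θ) ≡ subC (λ x → σ (ρ x)) θ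
  subC-ren σ ρ [] = refl
  subC-ren σ ρ (nothing ∷ θ) = cong (nothing ∷_) (subC-ren σ ρ θ)
  subC-ren σ ρ (just t ∷ θ) = cong₂ just∷ (sub-ren σ ρ t) (subC-ren σ ρ θ)

mutual
  ren-sub : ∀ ρ (σ : ℕ → Term n) (t : Term n) → ren ρ (sub σ t) ≡ sub (λ x → ren ρ (σ x)) t
  ren-sub ρ σ (var x) = refl
  ren-sub ρ σ (app t u) = cong₂ app (ren-sub ρ σ t) (ren-sub ρ σ u)
  ren-sub ρ σ (lam t) = cong lam (trans (ren-sub (ext ρ) (exts σ) t)
    (sub-cong (λ { zero → refl ; (suc x) → trans (ren-ren (ext ρ) suc (σ x)) (sym (ren-ren suc ρ (σ x))) }) t))
  ren-sub ρ σ (con c) = refl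
  ren-sub ρ σ (case θ t) = cong₂ case (renC-sub ρ σ θ) (ren-sub ρ σ t)

  renC-sub : ∀ {k} ρ (σ : ℕ → Term n) (θ : Cases n k) → renC ρ (subC σ θ) ≡ subC (λ x → ren ρ (σ x)) θ
  renC-sub ρ σ [] = refl
  renC-sub ρ σ (nothing ∷ θ) = cong (nothing ∷_) (renC-sub ρ σ θ)
  renC-sub ρ σ (just t ∷ θ) = cong₂ just∷ (ren-sub ρ σ t) (renC-sub ρ σ θ)

mutual
  sub-sub : ∀ (σ τ : ℕ → Term n) (t : Term n) → sub σ (sub τ t) ≡ sub (λ x → sub σ (τ x)) t
  sub-sub σ τ (var x) = refl
  sub-sub σ τ (app t u) = cong₂ app (sub-sub σ τ t) (sub-sub σ τ u)
  sub-sub σ τ (lam t) = cong lam (trans (sub-sub (exts σ) (exts τ) t)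
    (sub-cong (λ { zero → refl ; (suc x) → trans (sub-ren (exts σ) suc (τ x)) (sym (ren-sub suc σ (τ x))) }) t))
  sub-sub σ τ (con c) = refl
  sub-sub σ τ (case θ t) = cong₂ case (subC-sub σ τ θ) (sub-sub σ τ t)

  subC-sub : ∀ {k} (σ τ : ℕ → Term n) (θ : Cases n k) → subC σ (subC τ θ) ≡ subC (λ x → sub σ (τ x)) θ
  subC-sub σ τ [] = refl
  subC-sub σ τ (nothing ∷ θ) = cong (nothing ∷_) (subC-sub σ τ θ)
  subC-sub σ τ (just t ∷ θ) = cong₂ just∷ (sub-sub σ τ t) (subC-sub σ τ θ)

mutual
  sub-id : (t : Term n) → sub var t ≡ t
  sub-id (var x) = refl
  sub-id (app t u) = cong₂ app (sub-id t) (sub-id u)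
  sub-id (lam t) = cong lam (trans (sub-cong (λ { zero → refl ; (suc x) → refl }) t) (sub-id t))
  sub-id (con c) = refl
  sub-id (case θ t) = cong₂ case (subC-id θ) (sub-id t)

  subC-id : ∀ {k} (θ : Cases n k) → subC var θ ≡ θ
  subC-id [] = refl
  subC-id (nothing ∷ θ) = cong (nothing ∷_) (subC-id θ)
  subC-id (just t ∷ θ) = cong₂ just∷ (sub-id t) (subC-id θ)

mutual
  ren-as-sub : ∀ ρ (t : Term n) → ren ρ t ≡ sub (λ x → var (ρ x)) t
  ren-as-sub ρ (var x) = refl
  ren-as-sub ρ (app t u) = cong₂ app (ren-as-sub ρ t) (ren-as-sub ρ u)
  ren-as-sub ρ (lam t) = cong lam (trans (ren-as-sub (ext ρ) t) (sub-cong (λ { zero → refl ; (suc x) → refl }) t))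
  ren-as-sub ρ (con c) = refl
  ren-as-sub ρ (case θ t) = cong₂ case (renC-as-sub ρ θ) (ren-as-sub ρ t)

  renC-as-sub : ∀ {k} ρ (θ : Cases n k) → renC ρ θ ≡ subC (λ x → var (ρ x)) θ
  renC-as-sub ρ [] = refl
  renC-as-sub ρ (nothing ∷ θ) = cong (nothing ∷_) (renC-as-sub ρ θ)
  renC-as-sub ρ (just t ∷ θ) = cong₂ just∷ (ren-as-sub ρ t) (renC-as-sub ρ θ)

weaken-[] : ∀ (u t : Term n) → sub (single u) (weaken t) ≡ t
weaken-[] u t = trans (sub-ren (single u) suc t) (sub-id t)

subC-single-weakenC : ∀ {k} (u : Term n) (θ : Cases n k) → subC (single u) (weakenC θ) ≡ θ
subC-single-weakenC u θ = trans (subC-ren (single u) suc θ) (subC-id θ)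

[var0]-ren-ext-suc : ∀ (t : Term n) → sub (single (var zero)) (ren (ext suc) t) ≡ t
[var0]-ren-ext-suc t =
  trans (sub-ren (single (var zero)) (ext suc) t) (trans (sub-cong (λ { zero → refl ; (suc x) → refl }) t) (sub-id t))

exts-weaken : ∀ (σ : ℕ → Term n) (t : Term n) → sub (exts σ) (weaken t) ≡ weaken (sub σ t)
exts-weaken σ t = trans (sub-ren (exts σ) suc t) (sym (ren-sub suc σ t))

extsC-weakenC : ∀ {k} (σ : ℕ → Term n) (θ : Cases n k) → subC (exts σ) (weakenC θ) ≡ weakenC (subC σ θ)
extsC-weakenC σ θ = trans (subC-ren (exts σ) suc θ) (sym (renC-sub suc σ θ))

extC-weakenC : ∀ {k} ρ (θ : Cases n k) → renC (ext ρ) (weakenC θ) ≡ weakenC (renC ρ θ)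
extC-weakenC ρ θ = trans (renC-ren (ext ρ) suc θ) (sym (renC-ren suc ρ θ))

sub-[] : ∀ (σ : ℕ → Term n) (t u : Term n) → sub σ (t [ u ]) ≡ (sub (exts σ) t) [ sub σ u ]
sub-[] σ t u = trans (sub-sub σ (single u) t)
  (sym (trans (sub-sub (single (sub σ u)) (exts σ) t)
    (sub-cong (λ { zero → refl ; (suc x) → weaken-[] (sub σ u) (σ x) }) t)))

ren-[] : ∀ ρ (t u : Term n) → ren ρ (t [ u ]) ≡ (ren (ext ρ) t) [ ren ρ u ]
ren-[] ρ t u = trans (ren-sub ρ (single u) t)
  (sym (trans (sub-ren (single (ren ρ u)) (ext ρ) t) (sub-cong (λ { zero → refl ; (suc x) → refl }) t)))

lookup-ren : ∀ {k} ρ (θ : Cases n k) c → lookupC (renC ρ θ) c ≡ map (ren ρ) (lookupC θ c)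
lookup-ren ρ (nothing ∷ θ) zero = refl
lookup-ren ρ (just t ∷ θ) zero = refl
lookup-ren ρ (nothing ∷ θ) (suc c) = lookup-ren ρ θ c
lookup-ren ρ (just t ∷ θ) (suc c) = lookup-ren ρ θ c

lookup-sub : ∀ {k} σ (θ : Cases n k) c → lookupC (subC σ θ) c ≡ map (sub σ) (lookupC θ c)
lookup-sub σ (nothing ∷ θ) zero = refl
lookup-sub σ (just t ∷ θ) zero = refl
lookup-sub σ (nothing ∷ θ) (suc c) = lookup-sub σ θ c
lookup-sub σ (just t ∷ θ) (suc c) = lookup-sub σ θ c

subC-comp : ∀ {k} σ (θ : Cases n n) (φ : Cases n k) → subC σ (compC θ φ) ≡ compC (subC σ θ) (subC σ φ)
subC-comp σ θ [] = refl
subC-comp σ θ (nothing ∷ φ) = cong (nothing ∷_) (subC-comp σ θ φ)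
subC-comp σ θ (just t ∷ φ) = cong (just∷ _) (subC-comp σ θ φ)

infix 4 _⟶C*_

_⟶C*_ : ∀ {k} → Cases n k → Cases n k → Set
_⟶C*_ = Star _⟶C_

⟶*-appL : ∀ {t t' u : Term n} → t ⟶* t' → app t u ⟶* app t' u
⟶*-appL = gmap _ appL
⟶*-appR : ∀ {t u u' : Term n} → u ⟶* u' → app t u ⟶* app t u'
⟶*-appR = gmap _ appR
⟶*-app : ∀ {t t' u u' : Term n} → t ⟶* t' → u ⟶* u' → app t u ⟶* app t' u'
⟶*-app a b = ⟶*-appL a ◅◅ ⟶*-appR b
⟶*-lam : ∀ {t t' : Term n} → t ⟶* t' → lam t ⟶* lam t'
⟶*-lam = gmap _ lamC
⟶*-case : ∀ {θ θ' : Cases n n} {t t' : Term n} → θ ⟶C* θ' → t ⟶* t' → case θ t ⟶* case θ' t'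
⟶*-case a b = gmap _ caseBr a ◅◅ gmap _ caseBody b
⟶C*-just : ∀ {k} {t t' : Term n} {θ θ' : Cases n k} → t ⟶* t' → θ ⟶C* θ' → (just t ∷ θ) ⟶C* (just t' ∷ θ')
⟶C*-just a b = gmap _ here a ◅◅ gmap _ there b
⟶C*-nothing : ∀ {k} {θ θ' : Cases n k} → θ ⟶C* θ' → (nothing ∷ θ) ⟶C* (nothing ∷ θ')
⟶C*-nothing b = gmap _ there b

infix 4 _⟶ᶜ_ _⟶ᶜC_ _⟶ᶜ*_ _⟶ᶜC*_
mutual
  data _⟶ᶜ_ {n : ℕ} : Term n → Term n → Set where
    cLamApp   : ∀ {t} → lam (app (weaken t) (var zero)) ⟶ᶜ t
    cCaseCons : ∀ {θ c t} → lookupC θ c ≡ just t → case θ (con c) ⟶ᶜ t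
    cCaseApp  : ∀ {θ t u} → case θ (app t u) ⟶ᶜ app (case θ t) u
    cCaseLam  : ∀ {θ t} → case θ (lam t) ⟶ᶜ lam (case (weakenC θ) t)
    cCaseCase : ∀ {θ φ t} → case θ (case φ t) ⟶ᶜ case (compC θ φ) t
    cappL     : ∀ {t t' u} → t ⟶ᶜ t' → app t u ⟶ᶜ app t' u
    cappR     : ∀ {t u u'} → u ⟶ᶜ u' → app t u ⟶ᶜ app t u'
    clam      : ∀ {t t'} → t ⟶ᶜ t' → lam t ⟶ᶜ lam t'
    ccaseBody : ∀ {θ t t'} → t ⟶ᶜ t' → case θ t ⟶ᶜ case θ t'
    ccaseBr   : ∀ {θ θ' t} → θ ⟶ᶜC θ' → case θ t ⟶ᶜ case θ' t

  data _⟶ᶜC_ {n : ℕ} : ∀ {k} → Cases n k → Cases n k → Set where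
    chere  : ∀ {k t t'} {θ : Cases n k} → t ⟶ᶜ t' → just t ∷ θ ⟶ᶜC just t' ∷ θ
    cthere : ∀ {k m} {θ θ' : Cases n k} → θ ⟶ᶜC θ' → m ∷ θ ⟶ᶜC m ∷ θ'

_⟶ᶜ*_ : Term n → Term n → Set
_⟶ᶜ*_ = Star _⟶ᶜ_
_⟶ᶜC*_ : ∀ {k} → Cases n k → Cases n k → Set
_⟶ᶜC*_ = Star _⟶ᶜC_

mutual
  ⟶ᶜ⇒⟶ : ∀ {t t' : Term n} → t ⟶ᶜ t' → t ⟶ t'
  ⟶ᶜ⇒⟶ cLamApp = LamApp
  ⟶ᶜ⇒⟶ (cCaseCons e) = CaseCons e
  ⟶ᶜ⇒⟶ cCaseApp = CaseApp
  ⟶ᶜ⇒⟶ cCaseLam = CaseLam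
  ⟶ᶜ⇒⟶ cCaseCase = CaseCase
  ⟶ᶜ⇒⟶ (cappL s) = appL (⟶ᶜ⇒⟶ s)
  ⟶ᶜ⇒⟶ (cappR s) = appR (⟶ᶜ⇒⟶ s)
  ⟶ᶜ⇒⟶ (clam s) = lamC (⟶ᶜ⇒⟶ s)
  ⟶ᶜ⇒⟶ (ccaseBody s) = caseBody (⟶ᶜ⇒⟶ s)
  ⟶ᶜ⇒⟶ (ccaseBr s) = caseBr (⟶ᶜC⇒⟶C s)

  ⟶ᶜC⇒⟶C : ∀ {k} {θ θ' : Cases n k} → θ ⟶ᶜC θ' → θ ⟶C θ'
  ⟶ᶜC⇒⟶C (chere s) = here (⟶ᶜ⇒⟶ s)
  ⟶ᶜC⇒⟶C (cthere s) = there (⟶ᶜC⇒⟶C s)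

⟶ᶜ*⇒⟶* : ∀ {t t' : Term n} → t ⟶ᶜ* t' → t ⟶* t'
⟶ᶜ*⇒⟶* = gmap _ ⟶ᶜ⇒⟶

⟶ᶜ*-appL : ∀ {t t' u : Term n} → t ⟶ᶜ* t' → app t u ⟶ᶜ* app t' u
⟶ᶜ*-appL = gmap _ cappL
⟶ᶜ*-app : ∀ {t t' u u' : Term n} → t ⟶ᶜ* t' → u ⟶ᶜ* u' → app t u ⟶ᶜ* app t' u'
⟶ᶜ*-app a b = gmap _ cappL a ◅◅ gmap _ cappR b
⟶ᶜ*-lam : ∀ {t t' : Term n} → t ⟶ᶜ* t' → lam t ⟶ᶜ* lam t'
⟶ᶜ*-lam = gmap _ clam
⟶ᶜ*-case : ∀ {θ θ' : Cases n n} {t t' : Term n} → θ ⟶ᶜC* θ' → t ⟶ᶜ* t' → case θ t ⟶ᶜ* case θ' t'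
⟶ᶜ*-case a b = gmap _ ccaseBr a ◅◅ gmap _ ccaseBody b
⟶ᶜC*-just : ∀ {k} {t t' : Term n} {θ θ' : Cases n k} → t ⟶ᶜ* t' → θ ⟶ᶜC* θ' → (just t ∷ θ) ⟶ᶜC* (just t' ∷ θ')
⟶ᶜC*-just a b = gmap _ chere a ◅◅ gmap _ cthere b
⟶ᶜC*-nothing : ∀ {k} {θ θ' : Cases n k} → θ ⟶ᶜC* θ' → (nothing ∷ θ) ⟶ᶜC* (nothing ∷ θ')
⟶ᶜC*-nothing b = gmap _ cthere b

≡⇒⟶ᶜ* : ∀ {a b : Term n} → a ≡ b → a ⟶ᶜ* b
≡⇒⟶ᶜ* refl = ε

mutual
  ⟶ᶜ-sub : ∀ (σ : ℕ → Term n) {t t'} → t ⟶ᶜ t' → sub σ t ⟶ᶜ sub σ t'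
  ⟶ᶜ-sub σ (cLamApp {t}) = subst (λ z → lam (app z (var zero)) ⟶ᶜ sub σ t) (sym (exts-weaken σ t)) cLamApp
  ⟶ᶜ-sub σ (cCaseCons {θ} {c} {t} e) = cCaseCons (trans (lookup-sub σ θ c) (cong (map (sub σ)) e))
  ⟶ᶜ-sub σ cCaseApp = cCaseApp
  ⟶ᶜ-sub σ (cCaseLam {θ} {t}) =
    subst (λ z → sub σ (case θ (lam t)) ⟶ᶜ lam (case z (sub (exts σ) t))) (sym (extsC-weakenC σ θ)) cCaseLam
  ⟶ᶜ-sub σ (cCaseCase {θ} {φ} {t}) = subst (λ z → sub σ (case θ (case φ t)) ⟶ᶜ case z (sub σ t)) (sym (subC-comp σ θ φ)) cCaseCase
  ⟶ᶜ-sub σ (cappL s) = cappL (⟶ᶜ-sub σ s)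
  ⟶ᶜ-sub σ (cappR s) = cappR (⟶ᶜ-sub σ s)
  ⟶ᶜ-sub σ (clam s) = clam (⟶ᶜ-sub (exts σ) s)
  ⟶ᶜ-sub σ (ccaseBody s) = ccaseBody (⟶ᶜ-sub σ s)
  ⟶ᶜ-sub σ (ccaseBr s) = ccaseBr (⟶ᶜC-sub σ s)

  ⟶ᶜC-sub : ∀ {k} (σ : ℕ → Term n) {θ θ' : Cases n k} → θ ⟶ᶜC θ' → subC σ θ ⟶ᶜC subC σ θ'
  ⟶ᶜC-sub σ (chere s) = chere (⟶ᶜ-sub σ s)
  ⟶ᶜC-sub σ (cthere {m = nothing} s) = cthere (⟶ᶜC-sub σ s)
  ⟶ᶜC-sub σ (cthere {m = just x} s) = cthere (⟶ᶜC-sub σ s)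

⟶ᶜ*-sub : ∀ (σ : ℕ → Term n) {t t'} → t ⟶ᶜ* t' → sub σ t ⟶ᶜ* sub σ t'
⟶ᶜ*-sub σ = gmap _ (⟶ᶜ-sub σ)

⟶ᶜ*-ren : ∀ ρ {t t' : Term n} → t ⟶ᶜ* t' → ren ρ t ⟶ᶜ* ren ρ t'
⟶ᶜ*-ren ρ {t = t} {t'} s = subst₂ _⟶ᶜ*_ (sym (ren-as-sub ρ t)) (sym (ren-as-sub ρ t')) (⟶ᶜ*-sub (λ x → var (ρ x)) s)

mutual
  sub-⟶ᶜ* : ∀ {σ σ' : ℕ → Term n} → (∀ x → σ x ⟶ᶜ* σ' x) → (t : Term n) → sub σ t ⟶ᶜ* sub σ' t
  sub-⟶ᶜ* h (var x) = h x
  sub-⟶ᶜ* h (app t u) = ⟶ᶜ*-app (sub-⟶ᶜ* h t) (sub-⟶ᶜ* h u)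
  sub-⟶ᶜ* h (lam t) = ⟶ᶜ*-lam (sub-⟶ᶜ* (λ { zero → ε ; (suc x) → ⟶ᶜ*-ren suc (h x) }) t)
  sub-⟶ᶜ* h (con c) = ε
  sub-⟶ᶜ* h (case θ t) = ⟶ᶜ*-case (subC-⟶ᶜC* h θ) (sub-⟶ᶜ* h t)

  subC-⟶ᶜC* : ∀ {k} {σ σ' : ℕ → Term n} → (∀ x → σ x ⟶ᶜ* σ' x) → (θ : Cases n k) → subC σ θ ⟶ᶜC* subC σ' θ
  subC-⟶ᶜC* h [] = ε
  subC-⟶ᶜC* h (nothing ∷ θ) = ⟶ᶜC*-nothing (subC-⟶ᶜC* h θ)
  subC-⟶ᶜC* h (just t ∷ θ) = ⟶ᶜC*-just (sub-⟶ᶜ* h t) (subC-⟶ᶜC* h θ)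

⟶ᶜ*-[] : ∀ {t t' u u' : Term n} → t ⟶ᶜ* t' → u ⟶ᶜ* u' → t [ u ] ⟶ᶜ* t' [ u' ]
⟶ᶜ*-[] {t' = t'} {u = u} a b = ⟶ᶜ*-sub (single u) a ◅◅ sub-⟶ᶜ* (λ { zero → b ; (suc x) → ε }) t'

infix 4 _⇉_ _⇉C_

mutual
  data _⇉_ {n : ℕ} : Term n → Term n → Set where
    pvar  : ∀ {x} → var x ⇉ var x
    pcon  : ∀ {c} → con c ⇉ con c
    papp  : ∀ {t t' u u'} → t ⇉ t' → u ⇉ u' → app t u ⇉ app t' u'
    plam  : ∀ {t t'} → t ⇉ t' → lam t ⇉ lam t'
    pcase : ∀ {θ θ' t t'} → θ ⇉C θ' → t ⇉ t' → case θ t ⇉ case θ' t'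
    pbeta : ∀ {t t' u u'} → t ⇉ t' → u ⇉ u' → app (lam t) u ⇉ t' [ u' ]

  data _⇉C_ {n : ℕ} : ∀ {k} → Cases n k → Cases n k → Set where
    pnil     : [] ⇉C []
    pnothing : ∀ {k} {θ θ' : Cases n k} → θ ⇉C θ' → (nothing ∷ θ) ⇉C (nothing ∷ θ')
    pjust    : ∀ {k t t'} {θ θ' : Cases n k} → t ⇉ t' → θ ⇉C θ' → (just t ∷ θ) ⇉C (just t' ∷ θ')

mutual
  ⇉-refl : (t : Term n) → t ⇉ t
  ⇉-refl (var x) = pvar
  ⇉-refl (app t u) = papp (⇉-refl t) (⇉-refl u)
  ⇉-refl (lam t) = plam (⇉-refl t)
  ⇉-refl (con c) = pcon
  ⇉-refl (case θ t) = pcase (⇉C-refl θ) (⇉-refl t)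

  ⇉C-refl : ∀ {k} (θ : Cases n k) → θ ⇉C θ
  ⇉C-refl [] = pnil
  ⇉C-refl (nothing ∷ θ) = pnothing (⇉C-refl θ)
  ⇉C-refl (just t ∷ θ) = pjust (⇉-refl t) (⇉C-refl θ)

mutual
  ⇉-ren : ∀ ρ {t t' : Term n} → t ⇉ t' → ren ρ t ⇉ ren ρ t'
  ⇉-ren ρ pvar = pvar
  ⇉-ren ρ pcon = pcon
  ⇉-ren ρ (papp a b) = papp (⇉-ren ρ a) (⇉-ren ρ b)
  ⇉-ren ρ (plam a) = plam (⇉-ren (ext ρ) a)
  ⇉-ren ρ (pcase a b) = pcase (⇉C-ren ρ a) (⇉-ren ρ b)
  ⇉-ren ρ (pbeta {t' = t'} {u' = u'} a b) = subst (λ z → _ ⇉ z) (sym (ren-[] ρ t' u')) (pbeta (⇉-ren (ext ρ) a) (⇉-ren ρ b))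

  ⇉C-ren : ∀ {k} ρ {θ θ' : Cases n k} → θ ⇉C θ' → renC ρ θ ⇉C renC ρ θ'
  ⇉C-ren ρ pnil = pnil
  ⇉C-ren ρ (pnothing a) = pnothing (⇉C-ren ρ a)
  ⇉C-ren ρ (pjust a b) = pjust (⇉-ren ρ a) (⇉C-ren ρ b)

mutual
  ⇉-sub : ∀ {σ σ' : ℕ → Term n} → (∀ x → σ x ⇉ σ' x) → {t t' : Term n} → t ⇉ t' → sub σ t ⇉ sub σ' t'
  ⇉-sub h (pvar {x}) = h x
  ⇉-sub h pcon = pcon
  ⇉-sub h (papp a b) = papp (⇉-sub h a) (⇉-sub h b)
  ⇉-sub h (plam a) = plam (⇉-sub (λ { zero → pvar ; (suc x) → ⇉-ren suc (h x) }) a)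
  ⇉-sub h (pcase a b) = pcase (⇉C-sub h a) (⇉-sub h b)
  ⇉-sub {σ' = σ'} h (pbeta {t' = t'} {u' = u'} a b) = subst (λ z → _ ⇉ z) (sym (sub-[] σ' t' u'))
    (pbeta (⇉-sub (λ { zero → pvar ; (suc x) → ⇉-ren suc (h x) }) a) (⇉-sub h b))

  ⇉C-sub : ∀ {k} {σ σ' : ℕ → Term n} → (∀ x → σ x ⇉ σ' x) → {θ θ' : Cases n k} → θ ⇉C θ' → subC σ θ ⇉C subC σ' θ'
  ⇉C-sub h pnil = pnil
  ⇉C-sub h (pnothing a) = pnothing (⇉C-sub h a)
  ⇉C-sub h (pjust a b) = pjust (⇉-sub h a) (⇉C-sub h b)

⇉-[] : ∀ {t t' u u' : Term n} → t ⇉ t' → u ⇉ u' → t [ u ] ⇉ t' [ u' ]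
⇉-[] a b = ⇉-sub (λ { zero → b ; (suc x) → pvar }) a

mutual
  ⇉⇒⟶* : ∀ {t t' : Term n} → t ⇉ t' → t ⟶* t'
  ⇉⇒⟶* pvar = ε
  ⇉⇒⟶* pcon = ε
  ⇉⇒⟶* (papp a b) = ⟶*-app (⇉⇒⟶* a) (⇉⇒⟶* b)
  ⇉⇒⟶* (plam a) = ⟶*-lam (⇉⇒⟶* a)
  ⇉⇒⟶* (pcase a b) = ⟶*-case (⇉C⇒⟶C* a) (⇉⇒⟶* b)
  ⇉⇒⟶* (pbeta a b) = ⟶*-app (⟶*-lam (⇉⇒⟶* a)) (⇉⇒⟶* b) ◅◅ (AppLam ◅ ε)

  ⇉C⇒⟶C* : ∀ {k} {θ θ' : Cases n k} → θ ⇉C θ' → θ ⟶C* θ'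
  ⇉C⇒⟶C* pnil = ε
  ⇉C⇒⟶C* (pnothing a) = ⟶C*-nothing (⇉C⇒⟶C* a)
  ⇉C⇒⟶C* (pjust a b) = ⟶C*-just (⇉⇒⟶* a) (⇉C⇒⟶C* b)

mutual
  ⇉-ren⁻¹ : ∀ ρ (s : Term n) {Y} → ren ρ s ⇉ Y → ∃ λ s' → s ⇉ s' × Y ≡ ren ρ s'
  ⇉-ren⁻¹ ρ (var x) pvar = var x , pvar , refl
  ⇉-ren⁻¹ ρ (con c) pcon = con c , pcon , refl
  ⇉-ren⁻¹ ρ (lam r) (plam d) with ⇉-ren⁻¹ (ext ρ) r d
  ... | r' , d' , e = lam r' , plam d' , cong lam e
  ⇉-ren⁻¹ ρ (case θ t) (pcase dθ dt) with ⇉C-ren⁻¹ ρ θ dθ | ⇉-ren⁻¹ ρ t dt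
  ... | θ' , dθ' , e1 | t' , dt' , e2 = case θ' t' , pcase dθ' dt' , cong₂ case e1 e2
  ⇉-ren⁻¹ ρ (app (lam r) a) (papp (plam d) db) with ⇉-ren⁻¹ (ext ρ) r d | ⇉-ren⁻¹ ρ a db
  ... | r' , d' , e1 | a' , db' , e2 = app (lam r') a' , papp (plam d') db' , cong₂ app (cong lam e1) e2
  ⇉-ren⁻¹ ρ (app (lam r) a) (pbeta d db) with ⇉-ren⁻¹ (ext ρ) r d | ⇉-ren⁻¹ ρ a db
  ... | r' , d' , refl | a' , db' , refl = r' [ a' ] , pbeta d' db' , sym (ren-[] ρ r' a')
  ⇉-ren⁻¹ ρ (app f a) (papp d db) with ⇉-ren⁻¹ ρ f d | ⇉-ren⁻¹ ρ a db
  ... | f' , d' , e1 | a' , db' , e2 = app f' a' , papp d' db' , cong₂ app e1 e2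

  ⇉C-ren⁻¹ : ∀ {k} ρ (θ : Cases n k) {Θ} → renC ρ θ ⇉C Θ → ∃ λ θ' → θ ⇉C θ' × Θ ≡ renC ρ θ'
  ⇉C-ren⁻¹ ρ [] pnil = [] , pnil , refl
  ⇉C-ren⁻¹ ρ (nothing ∷ θ) (pnothing d) with ⇉C-ren⁻¹ ρ θ d
  ... | θ' , d' , e = nothing ∷ θ' , pnothing d' , cong (nothing ∷_) e
  ⇉C-ren⁻¹ ρ (just t ∷ θ) (pjust d1 d2) with ⇉-ren⁻¹ ρ t d1 | ⇉C-ren⁻¹ ρ θ d2
  ... | t' , d1' , e1 | θ' , d2' , e2 = just t' ∷ θ' , pjust d1' d2' , cong₂ just∷ e1 e2

⇉-η-body⁻¹ : (s : Term n) → {y : Term n} → app (weaken s) (var zero) ⇉ y →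
         (∃ λ s' → s ⇉ s' × y ≡ app (weaken s') (var zero)) ⊎
         (∃ λ r → ∃ λ r' → s ≡ lam r × r ⇉ r' × y ≡ r')
⇉-η-body⁻¹ (lam r) (papp (plam d) pvar) with ⇉-ren⁻¹ (ext suc) r d
... | r' , d' , e = inj₁ (lam r' , plam d' , cong (λ z → app (lam z) (var zero)) e)
⇉-η-body⁻¹ (lam r) (pbeta d pvar) with ⇉-ren⁻¹ (ext suc) r d
... | r' , d' , refl = inj₂ (r , r' , refl , d' , [var0]-ren-ext-suc r')
⇉-η-body⁻¹ s (papp d pvar) with ⇉-ren⁻¹ suc s d
... | s' , d' , e = inj₁ (s' , d' , cong (λ z → app z (var zero)) e)

mutual
  dev : Term n → Term n
  dev (var x) = var x
  dev (app t u) = devApp t (dev u)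
  dev (lam t) = lam (dev t)
  dev (con c) = con c
  dev (case θ t) = case (devC θ) (dev t)

  devApp : Term n → Term n → Term n
  devApp (lam t) v = dev t [ v ]
  devApp (var x) v = app (var x) v
  devApp (app t u) v = app (dev (app t u)) v
  devApp (con c) v = app (con c) v
  devApp (case θ t) v = app (dev (case θ t)) v

  devC : ∀ {k} → Cases n k → Cases n k
  devC [] = []
  devC (nothing ∷ θ) = nothing ∷ devC θ
  devC (just t ∷ θ) = just (dev t) ∷ devC θ

mutual
  ⇉-triangle : ∀ {t t' : Term n} → t ⇉ t' → t' ⇉ dev t
  ⇉-triangle pvar = pvar
  ⇉-triangle pcon = pcon
  ⇉-triangle (plam a) = plam (⇉-triangle a)
  ⇉-triangle (pcase a b) = pcase (⇉C-triangle a) (⇉-triangle b)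
  ⇉-triangle (pbeta a b) = ⇉-[] (⇉-triangle a) (⇉-triangle b)
  ⇉-triangle (papp (plam a) b) = pbeta (⇉-triangle a) (⇉-triangle b)
  ⇉-triangle (papp {t = var x} a b) = papp (⇉-triangle a) (⇉-triangle b)
  ⇉-triangle (papp {t = app _ _} a b) = papp (⇉-triangle a) (⇉-triangle b)
  ⇉-triangle (papp {t = con _} a b) = papp (⇉-triangle a) (⇉-triangle b)
  ⇉-triangle (papp {t = case _ _} a b) = papp (⇉-triangle a) (⇉-triangle b)

  ⇉C-triangle : ∀ {k} {θ θ' : Cases n k} → θ ⇉C θ' → θ' ⇉C devC θ
  ⇉C-triangle pnil = pnil
  ⇉C-triangle (pnothing a) = pnothing (⇉C-triangle a)
  ⇉C-triangle (pjust a b) = pjust (⇉-triangle a) (⇉C-triangle b)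

ext^ : ℕ → (ℕ → ℕ) → ℕ → ℕ
ext^ zero f = f
ext^ (suc k) f = ext (ext^ k f)

strengthenVar : ℕ → ℕ → Maybe ℕ
strengthenVar zero zero = nothing
strengthenVar zero (suc x) = just x
strengthenVar (suc k) zero = just zero
strengthenVar (suc k) (suc x) = map suc (strengthenVar k x)

strengthenVar-lift : ∀ k x → strengthenVar k (ext^ k suc x) ≡ just x
strengthenVar-lift zero x = refl
strengthenVar-lift (suc k) zero = refl
strengthenVar-lift (suc k) (suc x) = cong (map suc) (strengthenVar-lift k x)

strengthenVar-just⁻¹ : ∀ k x {y} → strengthenVar k x ≡ just y → x ≡ ext^ k suc y
strengthenVar-just⁻¹ zero zero ()
strengthenVar-just⁻¹ zero (suc x) refl = refl
strengthenVar-just⁻¹ (suc k) zero refl = refl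
strengthenVar-just⁻¹ (suc k) (suc x) e with map-just⁻¹ suc (strengthenVar k x) e
... | y' , e1 , refl = cong suc (strengthenVar-just⁻¹ k x e1)

strengthenVar-ext : ∀ k ρ x → strengthenVar k (ext^ k (ext ρ) x) ≡ map (ext^ k ρ) (strengthenVar k x)
strengthenVar-ext zero ρ zero = refl
strengthenVar-ext zero ρ (suc x) = refl
strengthenVar-ext (suc k) ρ zero = refl
strengthenVar-ext (suc k) ρ (suc x) =
  trans (cong (map suc) (strengthenVar-ext k ρ x)) (map-map (ext^ k ρ) suc suc (ext (ext^ k ρ)) (λ a → refl) (strengthenVar k x))

mutual
  strengthen : ℕ → Term n → Maybe (Term n)
  strengthen k (var x) = map var (strengthenVar k x)
  strengthen k (app t u) = zipWith app (strengthen k t) (strengthen k u)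
  strengthen k (lam t) = map lam (strengthen (suc k) t)
  strengthen k (con c) = just (con c)
  strengthen k (case θ t) = zipWith case (strengthenC k θ) (strengthen k t)

  strengthenC : ∀ {j} → ℕ → Cases n j → Maybe (Cases n j)
  strengthenC k [] = just []
  strengthenC k (nothing ∷ θ) = map (nothing ∷_) (strengthenC k θ)
  strengthenC k (just t ∷ θ) = zipWith just∷ (strengthen k t) (strengthenC k θ)

mutual
  strengthen-lift : ∀ k (t : Term n) → strengthen k (ren (ext^ k suc) t) ≡ just t
  strengthen-lift k (var x) = cong (map var) (strengthenVar-lift k x)
  strengthen-lift k (app t u) rewrite strengthen-lift k t | strengthen-lift k u = refl
  strengthen-lift k (lam t) rewrite strengthen-lift (suc k) t = refl
  strengthen-lift k (con c) = refl
  strengthen-lift k (case θ t) rewrite strengthenC-lift k θ | strengthen-lift k t = refl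

  strengthenC-lift : ∀ {j} k (θ : Cases n j) → strengthenC k (renC (ext^ k suc) θ) ≡ just θ
  strengthenC-lift k [] = refl
  strengthenC-lift k (nothing ∷ θ) rewrite strengthenC-lift k θ = refl
  strengthenC-lift k (just t ∷ θ) rewrite strengthen-lift k t | strengthenC-lift k θ = refl

mutual
  strengthen-just⁻¹ : ∀ k (t : Term n) {s} → strengthen k t ≡ just s → t ≡ ren (ext^ k suc) s
  strengthen-just⁻¹ k (var x) e with map-just⁻¹ var (strengthenVar k x) e
  ... | y , e1 , refl = cong var (strengthenVar-just⁻¹ k x e1)
  strengthen-just⁻¹ k (app t u) e with zipWith-just⁻¹ app (strengthen k t) (strengthen k u) e
  ... | a , b , e1 , e2 , refl = cong₂ app (strengthen-just⁻¹ k t e1) (strengthen-just⁻¹ k u e2)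
  strengthen-just⁻¹ k (lam t) e with map-just⁻¹ lam (strengthen (suc k) t) e
  ... | a , e1 , refl = cong lam (strengthen-just⁻¹ (suc k) t e1)
  strengthen-just⁻¹ k (con c) refl = refl
  strengthen-just⁻¹ k (case θ t) e with zipWith-just⁻¹ case (strengthenC k θ) (strengthen k t) e
  ... | a , b , e1 , e2 , refl = cong₂ case (strengthenC-just⁻¹ k θ e1) (strengthen-just⁻¹ k t e2)

  strengthenC-just⁻¹ : ∀ {j} k (θ : Cases n j) {s} → strengthenC k θ ≡ just s → θ ≡ renC (ext^ k suc) s
  strengthenC-just⁻¹ k [] refl = refl
  strengthenC-just⁻¹ k (nothing ∷ θ) e with map-just⁻¹ (nothing ∷_) (strengthenC k θ) e
  ... | a , e1 , refl = cong (nothing ∷_) (strengthenC-just⁻¹ k θ e1)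
  strengthenC-just⁻¹ k (just t ∷ θ) e with zipWith-just⁻¹ just∷ (strengthen k t) (strengthenC k θ) e
  ... | a , b , e1 , e2 , refl = cong₂ just∷ (strengthen-just⁻¹ k t e1) (strengthenC-just⁻¹ k θ e2)

mutual
  strengthen-ext : ∀ k ρ (t : Term n) → strengthen k (ren (ext^ k (ext ρ)) t) ≡ map (ren (ext^ k ρ)) (strengthen k t)
  strengthen-ext k ρ (var x) =
    trans (cong (map var) (strengthenVar-ext k ρ x)) (map-map (ext^ k ρ) var var (ren (ext^ k ρ)) (λ a → refl) (strengthenVar k x))
  strengthen-ext k ρ (app t u) rewrite strengthen-ext k ρ t | strengthen-ext k ρ u =
    zipWith-map app app (ren (ext^ k ρ)) (ren (ext^ k ρ)) (ren (ext^ k ρ)) (λ a b → refl) (strengthen k t) (strengthen k u)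
  strengthen-ext k ρ (lam t) rewrite strengthen-ext (suc k) ρ t =
    map-map (ren (ext^ (suc k) ρ)) lam lam (ren (ext^ k ρ)) (λ a → refl) (strengthen (suc k) t)
  strengthen-ext k ρ (con c) = refl
  strengthen-ext k ρ (case θ t) rewrite strengthenC-ext k ρ θ | strengthen-ext k ρ t =
    zipWith-map case case (renC (ext^ k ρ)) (ren (ext^ k ρ)) (ren (ext^ k ρ)) (λ a b → refl) (strengthenC k θ) (strengthen k t)

  strengthenC-ext : ∀ {j} k ρ (θ : Cases n j) → strengthenC k (renC (ext^ k (ext ρ)) θ) ≡ map (renC (ext^ k ρ)) (strengthenC k θ)
  strengthenC-ext k ρ [] = refl
  strengthenC-ext k ρ (nothing ∷ θ) rewrite strengthenC-ext k ρ θ =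
    map-map (renC (ext^ k ρ)) (nothing ∷_) (nothing ∷_) (renC (ext^ k ρ)) (λ a → refl) (strengthenC k θ)
  strengthenC-ext k ρ (just t ∷ θ) rewrite strengthen-ext k ρ t | strengthenC-ext k ρ θ =
    zipWith-map just∷ just∷ (ren (ext^ k ρ)) (renC (ext^ k ρ)) (renC (ext^ k ρ)) (λ a b → refl) (strengthen k t) (strengthenC k θ)

ηView : Term n → Maybe (Term n)
ηView (app y (var zero)) = strengthen 0 y
ηView _ = nothing

ηView-η : ∀ (s : Term n) → ηView (app (weaken s) (var zero)) ≡ just s
ηView-η s = strengthen-lift 0 s

ηView-just⁻¹ : ∀ (t : Term n) {s} → ηView t ≡ just s → t ≡ app (weaken s) (var zero)
ηView-just⁻¹ (app y (var zero)) e = cong (λ z → app z (var zero)) (strengthen-just⁻¹ 0 y e)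
ηView-just⁻¹ (var x) ()
ηView-just⁻¹ (app y (var (suc x))) ()
ηView-just⁻¹ (app y (app _ _)) ()
ηView-just⁻¹ (app y (lam _)) ()
ηView-just⁻¹ (app y (con _)) ()
ηView-just⁻¹ (app y (case _ _)) ()
ηView-just⁻¹ (lam t) ()
ηView-just⁻¹ (con c) ()
ηView-just⁻¹ (case θ t) ()

ηView-ren : ∀ ρ (t : Term n) → ηView (ren (ext ρ) t) ≡ map (ren ρ) (ηView t)
ηView-ren ρ (app y (var zero)) = strengthen-ext 0 ρ y
ηView-ren ρ (var x) = refl
ηView-ren ρ (app y (var (suc x))) = refl
ηView-ren ρ (app y (app _ _)) = refl
ηView-ren ρ (app y (lam _)) = refl
ηView-ren ρ (app y (con _)) = refl
ηView-ren ρ (app y (case _ _)) = refl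
ηView-ren ρ (lam t) = refl
ηView-ren ρ (con c) = refl
ηView-ren ρ (case θ t) = refl

-- lamη t and push θ t are the ⟶ᶜ-normal forms of lam t and case θ t for normal t, θ.
lamη : Term n → Term n
lamη t = maybe′ id (lam t) (ηView t)

lamη-η : ∀ (s : Term n) → lamη (app (weaken s) (var zero)) ≡ s
lamη-η s rewrite ηView-η s = refl

ren-lamη : ∀ ρ (x : Term n) → ren ρ (lamη x) ≡ lamη (ren (ext ρ) x)
ren-lamη ρ x with ηView x in e
... | just s rewrite ηView-ren ρ x | e = refl
... | nothing rewrite ηView-ren ρ x | e = refl

lam⟶ᶜ*lamη : ∀ (y : Term n) → lam y ⟶ᶜ* lamη y
lam⟶ᶜ*lamη y with ηView y in e
... | just s rewrite ηView-just⁻¹ y e = cLamApp ◅ ε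
... | nothing = ε

pushCon : Cases n n → Fin n → Maybe (Term n) → Term n
pushCon θ c (just u) = u
pushCon θ c nothing = case θ (con c)

infixr 6 _⊙_
mutual
  push : Cases n n → Term n → Term n
  push θ (var x) = case θ (var x)
  push θ (app t u) = app (push θ t) u
  push θ (lam t) = lamη (push (weakenC θ) t)
  push θ (con c) = pushCon θ c (lookupC θ c)
  push θ (case φ t) = push (θ ⊙ φ) t

  _⊙_ : ∀ {k} → Cases n n → Cases n k → Cases n k
  θ ⊙ [] = []
  θ ⊙ (nothing ∷ φ) = nothing ∷ (θ ⊙ φ)
  θ ⊙ (just u ∷ φ) = just (push θ u) ∷ (θ ⊙ φ)

mutual
  nf : Term n → Term n
  nf (var x) = var x
  nf (app t u) = app (nf t) (nf u)
  nf (lam t) = lamη (nf t)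
  nf (con c) = con c
  nf (case θ t) = push (nfC θ) (nf t)

  nfC : ∀ {k} → Cases n k → Cases n k
  nfC [] = []
  nfC (nothing ∷ θ) = nothing ∷ nfC θ
  nfC (just t ∷ θ) = just (nf t) ∷ nfC θ

lookup-⊙ : ∀ {k} (θ : Cases n n) (φ : Cases n k) c → lookupC (θ ⊙ φ) c ≡ map (push θ) (lookupC φ c)
lookup-⊙ θ (nothing ∷ φ) zero = refl
lookup-⊙ θ (just t ∷ φ) zero = refl
lookup-⊙ θ (nothing ∷ φ) (suc c) = lookup-⊙ θ φ c
lookup-⊙ θ (just t ∷ φ) (suc c) = lookup-⊙ θ φ c

lookup-nfC : ∀ {k} (θ : Cases n k) c → lookupC (nfC θ) c ≡ map nf (lookupC θ c)
lookup-nfC (nothing ∷ θ) zero = refl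
lookup-nfC (just t ∷ θ) zero = refl
lookup-nfC (nothing ∷ θ) (suc c) = lookup-nfC θ c
lookup-nfC (just t ∷ θ) (suc c) = lookup-nfC θ c

ren-pushCon : ∀ ρ (θ : Cases n n) c m → ren ρ (pushCon θ c m) ≡ pushCon (renC ρ θ) c (map (ren ρ) m)
ren-pushCon ρ θ c (just x) = refl
ren-pushCon ρ θ c nothing = refl

mutual
  ren-push : ∀ ρ (θ : Cases n n) (t : Term n) → ren ρ (push θ t) ≡ push (renC ρ θ) (ren ρ t)
  ren-push ρ θ (var x) = refl
  ren-push ρ θ (app t u) = cong (λ z → app z (ren ρ u)) (ren-push ρ θ t)
  ren-push ρ θ (lam t) = trans (ren-lamη ρ (push (weakenC θ) t))
    (cong lamη (trans (ren-push (ext ρ) (weakenC θ) t) (cong (λ z → push z (ren (ext ρ) t)) (extC-weakenC ρ θ))))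
  ren-push ρ θ (con c) = trans (ren-pushCon ρ θ c (lookupC θ c)) (cong (pushCon (renC ρ θ) c) (sym (lookup-ren ρ θ c)))
  ren-push ρ θ (case φ t) = trans (ren-push ρ (θ ⊙ φ) t) (cong (λ z → push z (ren ρ t)) (renC-⊙ ρ θ φ))

  renC-⊙ : ∀ {k} ρ (θ : Cases n n) (φ : Cases n k) → renC ρ (θ ⊙ φ) ≡ renC ρ θ ⊙ renC ρ φ
  renC-⊙ ρ θ [] = refl
  renC-⊙ ρ θ (nothing ∷ φ) = cong (nothing ∷_) (renC-⊙ ρ θ φ)
  renC-⊙ ρ θ (just u ∷ φ) = cong₂ just∷ (ren-push ρ θ u) (renC-⊙ ρ θ φ)

mutual
  ren-nf : ∀ ρ (t : Term n) → ren ρ (nf t) ≡ nf (ren ρ t)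
  ren-nf ρ (var x) = refl
  ren-nf ρ (app t u) = cong₂ app (ren-nf ρ t) (ren-nf ρ u)
  ren-nf ρ (lam t) = trans (ren-lamη ρ (nf t)) (cong lamη (ren-nf (ext ρ) t))
  ren-nf ρ (con c) = refl
  ren-nf ρ (case θ t) = trans (ren-push ρ (nfC θ) (nf t)) (cong₂ push (renC-nfC ρ θ) (ren-nf ρ t))

  renC-nfC : ∀ {k} ρ (θ : Cases n k) → renC ρ (nfC θ) ≡ nfC (renC ρ θ)
  renC-nfC ρ [] = refl
  renC-nfC ρ (nothing ∷ θ) = cong (nothing ∷_) (renC-nfC ρ θ)
  renC-nfC ρ (just t ∷ θ) = cong₂ just∷ (ren-nf ρ t) (renC-nfC ρ θ)

push-lamη : ∀ (θ : Cases n n) (x : Term n) → push θ (lamη x) ≡ lamη (push (weakenC θ) x)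
push-lamη θ x with ηView x in e
... | just s rewrite ηView-just⁻¹ x e =
      sym (trans (cong (λ z → lamη (app z (var zero))) (sym (ren-push suc θ s))) (lamη-η (push θ s)))
... | nothing = refl

mutual
  push-push : ∀ (θ φ : Cases n n) (t : Term n) → push θ (push φ t) ≡ push (θ ⊙ φ) t
  push-push θ φ (var x) = refl
  push-push θ φ (app t u) = cong (λ z → app z u) (push-push θ φ t)
  push-push θ φ (lam t) = trans (push-lamη θ (push (weakenC φ) t))
    (cong lamη (trans (push-push (weakenC θ) (weakenC φ) t) (cong (λ z → push z t) (sym (renC-⊙ suc θ φ)))))
  push-push θ φ (con c) with lookupC φ c in e
  ... | just u rewrite lookup-⊙ θ φ c | e = refl
  ... | nothing rewrite lookup-⊙ θ φ c | e = refl
  push-push θ φ (case ψ t) = trans (push-push θ (φ ⊙ ψ) t) (cong (λ z → push z t) (⊙-assoc θ φ ψ))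

  ⊙-assoc : ∀ {k} (θ φ : Cases n n) (ψ : Cases n k) → θ ⊙ (φ ⊙ ψ) ≡ (θ ⊙ φ) ⊙ ψ
  ⊙-assoc θ φ [] = refl
  ⊙-assoc θ φ (nothing ∷ ψ) = cong (nothing ∷_) (⊙-assoc θ φ ψ)
  ⊙-assoc θ φ (just u ∷ ψ) = cong₂ just∷ (push-push θ φ u) (⊙-assoc θ φ ψ)

nfC-compC : ∀ {k} (θ : Cases n n) (φ : Cases n k) → nfC (compC θ φ) ≡ nfC θ ⊙ nfC φ
nfC-compC θ [] = refl
nfC-compC θ (nothing ∷ φ) = cong (nothing ∷_) (nfC-compC θ φ)
nfC-compC θ (just u ∷ φ) = cong (just∷ _) (nfC-compC θ φ)

mutual
  nf-⟶ᶜ : ∀ {t t' : Term n} → t ⟶ᶜ t' → nf t ≡ nf t'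
  nf-⟶ᶜ (cLamApp {t}) = trans (cong (λ z → lamη (app z (var zero))) (sym (ren-nf suc t))) (lamη-η (nf t))
  nf-⟶ᶜ (cCaseCons {θ} {c} {t} e) rewrite lookup-nfC θ c | e = refl
  nf-⟶ᶜ cCaseApp = refl
  nf-⟶ᶜ (cCaseLam {θ} {t}) = trans (push-lamη (nfC θ) (nf t)) (cong (λ z → lamη (push z (nf t))) (renC-nfC suc θ))
  nf-⟶ᶜ (cCaseCase {θ} {φ} {t}) = trans (push-push (nfC θ) (nfC φ) (nf t)) (cong (λ z → push z (nf t)) (sym (nfC-compC θ φ)))
  nf-⟶ᶜ (cappL s) = cong (λ z → app z _) (nf-⟶ᶜ s)
  nf-⟶ᶜ (cappR s) = cong (app _) (nf-⟶ᶜ s)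
  nf-⟶ᶜ (clam s) = cong lamη (nf-⟶ᶜ s)
  nf-⟶ᶜ (ccaseBody s) = cong (push _) (nf-⟶ᶜ s)
  nf-⟶ᶜ (ccaseBr {t = t} s) = cong (λ z → push z (nf t)) (nfC-⟶ᶜC s)

  nfC-⟶ᶜC : ∀ {k} {θ θ' : Cases n k} → θ ⟶ᶜC θ' → nfC θ ≡ nfC θ'
  nfC-⟶ᶜC (chere s) = cong (λ z → just z ∷ _) (nf-⟶ᶜ s)
  nfC-⟶ᶜC (cthere {m = nothing} s) = cong (nothing ∷_) (nfC-⟶ᶜC s)
  nfC-⟶ᶜC (cthere {m = just x} s) = cong (just∷ _) (nfC-⟶ᶜC s)

nf-⟶ᶜ* : ∀ {t t' : Term n} → t ⟶ᶜ* t' → nf t ≡ nf t'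
nf-⟶ᶜ* ε = refl
nf-⟶ᶜ* (s ◅ ss) = trans (nf-⟶ᶜ s) (nf-⟶ᶜ* ss)

mutual
  case⟶ᶜ*push : ∀ (θ : Cases n n) (x : Term n) → case θ x ⟶ᶜ* push θ x
  case⟶ᶜ*push θ (var x) = ε
  case⟶ᶜ*push θ (app t u) = cCaseApp ◅ ⟶ᶜ*-appL (case⟶ᶜ*push θ t)
  case⟶ᶜ*push θ (lam t) = cCaseLam ◅ (⟶ᶜ*-lam (case⟶ᶜ*push (weakenC θ) t) ◅◅ lam⟶ᶜ*lamη _)
  case⟶ᶜ*push θ (con c) with lookupC θ c in e
  ... | just u = cCaseCons e ◅ ε
  ... | nothing = ε
  case⟶ᶜ*push θ (case φ t) = cCaseCase ◅ (⟶ᶜ*-case (compC⟶ᶜC*⊙ θ φ) ε ◅◅ case⟶ᶜ*push (θ ⊙ φ) t)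

  compC⟶ᶜC*⊙ : ∀ {k} (θ : Cases n n) (φ : Cases n k) → compC θ φ ⟶ᶜC* (θ ⊙ φ)
  compC⟶ᶜC*⊙ θ [] = ε
  compC⟶ᶜC*⊙ θ (nothing ∷ φ) = ⟶ᶜC*-nothing (compC⟶ᶜC*⊙ θ φ)
  compC⟶ᶜC*⊙ θ (just u ∷ φ) = ⟶ᶜC*-just (case⟶ᶜ*push θ u) (compC⟶ᶜC*⊙ θ φ)

mutual
  ⟶ᶜ*nf : ∀ (t : Term n) → t ⟶ᶜ* nf t
  ⟶ᶜ*nf (var x) = ε
  ⟶ᶜ*nf (app t u) = ⟶ᶜ*-app (⟶ᶜ*nf t) (⟶ᶜ*nf u)
  ⟶ᶜ*nf (lam t) = ⟶ᶜ*-lam (⟶ᶜ*nf t) ◅◅ lam⟶ᶜ*lamη (nf t)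
  ⟶ᶜ*nf (con c) = ε
  ⟶ᶜ*nf (case θ t) = ⟶ᶜ*-case (⟶ᶜC*nfC θ) (⟶ᶜ*nf t) ◅◅ case⟶ᶜ*push (nfC θ) (nf t)

  ⟶ᶜC*nfC : ∀ {k} (θ : Cases n k) → θ ⟶ᶜC* nfC θ
  ⟶ᶜC*nfC [] = ε
  ⟶ᶜC*nfC (nothing ∷ θ) = ⟶ᶜC*-nothing (⟶ᶜC*nfC θ)
  ⟶ᶜC*nfC (just t ∷ θ) = ⟶ᶜC*-just (⟶ᶜ*nf t) (⟶ᶜC*nfC θ)

nf-idem : ∀ (t : Term n) → nf (nf t) ≡ nf t
nf-idem t = sym (nf-⟶ᶜ* (⟶ᶜ*nf t))

⇉-lamη : ∀ {x y : Term n} → x ⇉ y → ∃ λ c → lamη x ⇉ c × lam y ⟶ᶜ* c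
⇉-lamη {x = x} {y} d with ηView x in e
... | nothing = lam y , plam d , ε
... | just s with ⇉-η-body⁻¹ s (subst (λ z → z ⇉ y) (ηView-just⁻¹ x e) d)
...   | inj₁ (s' , ds , refl) = s' , ds , cLamApp ◅ ε
...   | inj₂ (r , r' , refl , dr , refl) = lam r' , plam dr , ε

⇉-lamη-β : ∀ {x y u u₂ : Term n} → x ⇉ y → u ⇉ u₂ → ∃ λ c → app (lamη x) u ⇉ c × y [ u₂ ] ⟶ᶜ* c
⇉-lamη-β {x = x} {y} {u} {u₂} d du with ηView x in e
... | nothing = y [ u₂ ] , pbeta d du , ε
... | just s with ⇉-η-body⁻¹ s (subst (λ z → z ⇉ y) (ηView-just⁻¹ x e) d)
...   | inj₁ (s' , ds , refl) = app s' u₂ , papp ds du , ≡⇒⟶ᶜ* (cong (λ z → app z u₂) (weaken-[] u₂ s'))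
...   | inj₂ (r , r' , refl , dr , refl) = r' [ u₂ ] , pbeta dr du , ε

lookup-⇉C : ∀ {k} {θ θ₂ : Cases n k} → θ ⇉C θ₂ → ∀ c →
      (lookupC θ c ≡ nothing × lookupC θ₂ c ≡ nothing) ⊎
      ∃ λ u → ∃ λ u₂ → lookupC θ c ≡ just u × lookupC θ₂ c ≡ just u₂ × u ⇉ u₂
lookup-⇉C (pnothing d) zero = inj₁ (refl , refl)
lookup-⇉C (pjust d1 d2) zero = inj₂ (_ , _ , refl , refl , d1)
lookup-⇉C (pnothing d) (suc c) = lookup-⇉C d c
lookup-⇉C (pjust d1 d2) (suc c) = lookup-⇉C d2 c

mutual
  ⇉-push : ∀ {θ θ₂ : Cases n n} {x y : Term n} → θ ⇉C θ₂ → x ⇉ y → ∃ λ c → push θ x ⇉ c × case θ₂ y ⟶ᶜ* c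
  ⇉-push {θ₂ = θ₂} dθ (pvar {x}) = case θ₂ (var x) , pcase dθ pvar , ε
  ⇉-push {θ = θ} {θ₂} dθ (pcon {c}) with lookup-⇉C dθ c
  ... | inj₁ (e1 , e2) rewrite e1 = case θ₂ (con c) , pcase dθ pcon , ε
  ... | inj₂ (u , u₂ , e1 , e2 , d) rewrite e1 = u₂ , d , cCaseCons e2 ◅ ε
  ⇉-push dθ (papp {u' = u₂} d1 d2) with ⇉-push dθ d1
  ... | c1 , e1 , r1 = app c1 u₂ , papp e1 d2 , cCaseApp ◅ ⟶ᶜ*-appL r1
  ⇉-push dθ (plam d) with ⇉-push (⇉C-ren suc dθ) d
  ... | c1 , e1 , r1 with ⇉-lamη e1
  ...   | c , e2 , r2 = c , e2 , cCaseLam ◅ (⟶ᶜ*-lam r1 ◅◅ r2)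
  ⇉-push dθ (pcase dφ dt) with ⇉-⊙ dθ dφ
  ... | ψ , eψ , rψ with ⇉-push eψ dt
  ...   | c , e , r = c , e , cCaseCase ◅ (⟶ᶜ*-case rψ ε ◅◅ r)
  ⇉-push {θ₂ = θ₂} dθ (pbeta {t' = t₂} {u' = u₂} d du) with ⇉-push (⇉C-ren suc dθ) d
  ... | c1 , e1 , r1 with ⇉-lamη-β e1 du
  ...   | c , e2 , r2 = c , e2 ,
          (subst (λ z → case z (t₂ [ u₂ ]) ⟶ᶜ* c1 [ u₂ ]) (subC-single-weakenC u₂ θ₂) (⟶ᶜ*-sub (single u₂) r1) ◅◅ r2)

  ⇉-⊙ : ∀ {k} {θ θ₂ : Cases n n} {φ φ₂ : Cases n k} → θ ⇉C θ₂ → φ ⇉C φ₂ →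
        ∃ λ ψ → (θ ⊙ φ) ⇉C ψ × compC θ₂ φ₂ ⟶ᶜC* ψ
  ⇉-⊙ dθ pnil = [] , pnil , ε
  ⇉-⊙ dθ (pnothing dφ) with ⇉-⊙ dθ dφ
  ... | ψ , e , r = nothing ∷ ψ , pnothing e , ⟶ᶜC*-nothing r
  ⇉-⊙ dθ (pjust du dφ) with ⇉-push dθ du | ⇉-⊙ dθ dφ
  ... | cu , eu , ru | ψ , e , r = just cu ∷ ψ , pjust eu e , ⟶ᶜC*-just ru r

mutual
  ⇉-nf : ∀ {a b : Term n} → a ⇉ b → ∃ λ c → nf a ⇉ c × b ⟶ᶜ* c
  ⇉-nf (pvar {x}) = var x , pvar , ε
  ⇉-nf (pcon {c}) = con c , pcon , ε
  ⇉-nf (papp d1 d2) with ⇉-nf d1 | ⇉-nf d2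
  ... | c1 , e1 , r1 | c2 , e2 , r2 = app c1 c2 , papp e1 e2 , ⟶ᶜ*-app r1 r2
  ⇉-nf (plam d) with ⇉-nf d
  ... | c1 , e1 , r1 with ⇉-lamη e1
  ...   | c , e2 , r2 = c , e2 , (⟶ᶜ*-lam r1 ◅◅ r2)
  ⇉-nf (pcase dθ dt) with ⇉C-nfC dθ | ⇉-nf dt
  ... | cθ , eθ , rθ | ct , et , rt with ⇉-push eθ et
  ...   | c , e , r = c , e , (⟶ᶜ*-case rθ rt ◅◅ r)
  ⇉-nf (pbeta d du) with ⇉-nf d | ⇉-nf du
  ... | ct , et , rt | cu , eu , ru with ⇉-lamη-β et eu
  ...   | c , e , r = c , e , (⟶ᶜ*-[] rt ru ◅◅ r)

  ⇉C-nfC : ∀ {k} {θ θ' : Cases n k} → θ ⇉C θ' → ∃ λ c → nfC θ ⇉C c × θ' ⟶ᶜC* c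
  ⇉C-nfC pnil = [] , pnil , ε
  ⇉C-nfC (pnothing d) with ⇉C-nfC d
  ... | c , e , r = nothing ∷ c , pnothing e , ⟶ᶜC*-nothing r
  ⇉C-nfC (pjust d1 d2) with ⇉-nf d1 | ⇉C-nfC d2
  ... | c1 , e1 , r1 | c2 , e2 , r2 = just c1 ∷ c2 , pjust e1 e2 , ⟶ᶜC*-just r1 r2

mutual
  ⟶-split : ∀ {x y : Term n} → x ⟶ y → x ⟶ᶜ y ⊎ x ⇉ y
  ⟶-split (AppLam {t} {u}) = inj₂ (pbeta (⇉-refl t) (⇉-refl u))
  ⟶-split LamApp = inj₁ cLamApp
  ⟶-split (CaseCons e) = inj₁ (cCaseCons e)
  ⟶-split CaseApp = inj₁ cCaseApp
  ⟶-split CaseLam = inj₁ cCaseLam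
  ⟶-split CaseCase = inj₁ cCaseCase
  ⟶-split (appL {u = u} s) with ⟶-split s
  ... | inj₁ c = inj₁ (cappL c)
  ... | inj₂ d = inj₂ (papp d (⇉-refl u))
  ⟶-split (appR {t = t} s) with ⟶-split s
  ... | inj₁ c = inj₁ (cappR c)
  ... | inj₂ d = inj₂ (papp (⇉-refl t) d)
  ⟶-split (lamC s) with ⟶-split s
  ... | inj₁ c = inj₁ (clam c)
  ... | inj₂ d = inj₂ (plam d)
  ⟶-split (caseBody {θ = θ} s) with ⟶-split s
  ... | inj₁ c = inj₁ (ccaseBody c)
  ... | inj₂ d = inj₂ (pcase (⇉C-refl θ) d)
  ⟶-split (caseBr {t = t} s) with ⟶C-split s
  ... | inj₁ c = inj₁ (ccaseBr c)
  ... | inj₂ d = inj₂ (pcase d (⇉-refl t))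

  ⟶C-split : ∀ {k} {θ θ' : Cases n k} → θ ⟶C θ' → θ ⟶ᶜC θ' ⊎ θ ⇉C θ'
  ⟶C-split (here {θ = θ} s) with ⟶-split s
  ... | inj₁ c = inj₁ (chere c)
  ... | inj₂ d = inj₂ (pjust d (⇉C-refl θ))
  ⟶C-split (there {m = m} s) with ⟶C-split s
  ... | inj₁ c = inj₁ (cthere c)
  ... | inj₂ d = inj₂ (⇉C-cons m d)
    where
    ⇉C-cons : ∀ {k} (m : Maybe (Term n)) {θ θ' : Cases n k} → θ ⇉C θ' → (m ∷ θ) ⇉C (m ∷ θ')
    ⇉C-cons nothing d = pnothing d
    ⇉C-cons (just t) d = pjust (⇉-refl t) d

infix 4 _▷_

data _▷_ (x y : Term n) : Set where
  mk▷ : (r : Term n) → nf x ⇉ r → nf r ≡ nf y → x ▷ y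

⟶⇒▷ : ∀ {x y : Term n} → x ⟶ y → x ▷ y
⟶⇒▷ {x = x} s with ⟶-split s
... | inj₁ c = mk▷ (nf x) (⇉-refl (nf x)) (trans (nf-idem x) (nf-⟶ᶜ c))
... | inj₂ d with ⇉-nf d
...   | c , e , r = mk▷ c e (sym (nf-⟶ᶜ* r))

▷-triangle : ∀ {x y : Term n} → x ▷ y → y ▷ dev (nf x)
▷-triangle (mk▷ r d e) with ⇉-nf (⇉-triangle d)
... | c , e' , rr = mk▷ c (subst (λ z → z ⇉ c) e e') (sym (nf-⟶ᶜ* rr))

▷⇒nf⟶* : ∀ {x y : Term n} → x ▷ y → nf x ⟶* nf y
▷⇒nf⟶* (mk▷ r d e) = ⇉⇒⟶* d ◅◅ subst (r ⟶*_) e (⟶ᶜ*⇒⟶* (⟶ᶜ*nf r))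

⟶-churchRosser : ∀ {x y : Term n} → x ≡λC y → ∃ λ w → x ⟶* w × y ⟶* w
⟶-churchRosser {x = x} {y} x≡y
  with confluent⇒churchRosser (triangle⇒confluent (λ t → dev (nf t)) ▷-triangle) (EqClosure.map ⟶⇒▷ x≡y)
... | w , x▷*w , y▷*w = nf w , reduce x x▷*w , reduce y y▷*w
  where
  reduce : ∀ t → Star _▷_ t w → t ⟶* nf w
  reduce t t▷*w = ⟶ᶜ*⇒⟶* (⟶ᶜ*nf t) ◅◅ concat (gmap nf ▷⇒nf⟶* t▷*w)

-- Match failures under case-bindings: this covers {}·c₁ and is closed under reduction.
data Junk {n : ℕ} : Term n → Set where
  jbase : ∀ {θ c} → lookupC θ c ≡ nothing → Junk (case θ (con c))
  jcase : ∀ {θ j} → Junk j → Junk (case θ j)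

mutual
  data Completes {n : ℕ} : Term n → Term n → Set where
    dvar  : ∀ {x} → Completes (var x) (var x)
    dcon  : ∀ {c} → Completes (con c) (con c)
    dapp  : ∀ {t t' u u'} → Completes t t' → Completes u u' → Completes (app t u) (app t' u')
    dlam  : ∀ {t t'} → Completes t t' → Completes (lam t) (lam t')
    dcase : ∀ {θ θ' t t'} → CompletesC θ θ' → Completes t t' → Completes (case θ t) (case θ' t')

  data CompletesC {n : ℕ} : ∀ {k} → Cases n k → Cases n k → Set where
    dnil     : CompletesC [] []
    dnothing : ∀ {k} {θ θ' : Cases n k} → CompletesC θ θ' → CompletesC (nothing ∷ θ) (nothing ∷ θ')
    djust    : ∀ {k t t'} {θ θ' : Cases n k} → Completes t t' → CompletesC θ θ' → CompletesC (just t ∷ θ) (just t' ∷ θ')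
    djunk    : ∀ {k j} {θ θ' : Cases n k} → Junk j → CompletesC θ θ' → CompletesC (just j ∷ θ) (nothing ∷ θ')

Junk-sub : ∀ σ {j : Term n} → Junk j → Junk (sub σ j)
Junk-sub σ (jbase {θ} {c} e) = jbase (trans (lookup-sub σ θ c) (map-nothing e))
Junk-sub σ (jcase j) = jcase (Junk-sub σ j)

Junk-ren : ∀ ρ {j : Term n} → Junk j → Junk (ren ρ j)
Junk-ren ρ (jbase {θ} {c} e) = jbase (trans (lookup-ren ρ θ c) (map-nothing e))
Junk-ren ρ (jcase j) = jcase (Junk-ren ρ j)

mutual
  Completes-ren : ∀ ρ {u s : Term n} → Completes u s → Completes (ren ρ u) (ren ρ s)
  Completes-ren ρ dvar = dvar
  Completes-ren ρ dcon = dcon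
  Completes-ren ρ (dapp a b) = dapp (Completes-ren ρ a) (Completes-ren ρ b)
  Completes-ren ρ (dlam a) = dlam (Completes-ren (ext ρ) a)
  Completes-ren ρ (dcase a b) = dcase (CompletesC-ren ρ a) (Completes-ren ρ b)

  CompletesC-ren : ∀ {k} ρ {θ θ' : Cases n k} → CompletesC θ θ' → CompletesC (renC ρ θ) (renC ρ θ')
  CompletesC-ren ρ dnil = dnil
  CompletesC-ren ρ (dnothing a) = dnothing (CompletesC-ren ρ a)
  CompletesC-ren ρ (djust a b) = djust (Completes-ren ρ a) (CompletesC-ren ρ b)
  CompletesC-ren ρ (djunk j b) = djunk (Junk-ren ρ j) (CompletesC-ren ρ b)

mutual
  Completes-sub : ∀ {σ σ' : ℕ → Term n} → (∀ x → Completes (σ x) (σ' x)) → ∀ {u s} → Completes u s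
      → Completes (sub σ u) (sub σ' s)
  Completes-sub h (dvar {x}) = h x
  Completes-sub h dcon = dcon
  Completes-sub h (dapp a b) = dapp (Completes-sub h a) (Completes-sub h b)
  Completes-sub h (dlam a) = dlam (Completes-sub (λ { zero → dvar ; (suc x) → Completes-ren suc (h x) }) a)
  Completes-sub h (dcase a b) = dcase (CompletesC-sub h a) (Completes-sub h b)

  CompletesC-sub : ∀ {k} {σ σ' : ℕ → Term n} → (∀ x → Completes (σ x) (σ' x))
      → ∀ {θ θ' : Cases n k} → CompletesC θ θ' → CompletesC (subC σ θ) (subC σ' θ')
  CompletesC-sub h dnil = dnil
  CompletesC-sub h (dnothing a) = dnothing (CompletesC-sub h a)
  CompletesC-sub h (djust a b) = djust (Completes-sub h a) (CompletesC-sub h b)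
  CompletesC-sub {σ = σ} h (djunk j b) = djunk (Junk-sub σ j) (CompletesC-sub h b)

Junk-ren⁻¹ : ∀ ρ (a : Term n) → Junk (ren ρ a) → Junk a
Junk-ren⁻¹ ρ (case θ (con c)) (jbase e) = jbase (map-nothing⁻¹ (ren ρ) (lookupC θ c) (trans (sym (lookup-ren ρ θ c)) e))
Junk-ren⁻¹ ρ (case θ (con c)) (jcase ())
Junk-ren⁻¹ ρ (case θ (var x)) (jcase ())
Junk-ren⁻¹ ρ (case θ (app _ _)) (jcase ())
Junk-ren⁻¹ ρ (case θ (lam _)) (jcase ())
Junk-ren⁻¹ ρ (case θ (case φ t)) (jcase j) = jcase (Junk-ren⁻¹ ρ (case φ t) j)

mutual
  Completes-ren⁻¹ : ∀ ρ (a : Term n) {x} → Completes (ren ρ a) x → ∃ λ y → x ≡ ren ρ y × Completes a y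
  Completes-ren⁻¹ ρ (var i) dvar = var i , refl , dvar
  Completes-ren⁻¹ ρ (con c) dcon = con c , refl , dcon
  Completes-ren⁻¹ ρ (app a b) (dapp d1 d2) with Completes-ren⁻¹ ρ a d1 | Completes-ren⁻¹ ρ b d2
  ... | y1 , refl , e1 | y2 , refl , e2 = app y1 y2 , refl , dapp e1 e2
  Completes-ren⁻¹ ρ (lam a) (dlam d) with Completes-ren⁻¹ (ext ρ) a d
  ... | y , refl , e = lam y , refl , dlam e
  Completes-ren⁻¹ ρ (case θ a) (dcase d1 d2) with CompletesC-ren⁻¹ ρ θ d1 | Completes-ren⁻¹ ρ a d2
  ... | y1 , refl , e1 | y2 , refl , e2 = case y1 y2 , refl , dcase e1 e2

  CompletesC-ren⁻¹ : ∀ {k} ρ (θ : Cases n k) {x} → CompletesC (renC ρ θ) x → ∃ λ y → x ≡ renC ρ y × CompletesC θ y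
  CompletesC-ren⁻¹ ρ [] dnil = [] , refl , dnil
  CompletesC-ren⁻¹ ρ (nothing ∷ θ) (dnothing d) with CompletesC-ren⁻¹ ρ θ d
  ... | y , refl , e = nothing ∷ y , refl , dnothing e
  CompletesC-ren⁻¹ ρ (just t ∷ θ) (djust d1 d2) with Completes-ren⁻¹ ρ t d1 | CompletesC-ren⁻¹ ρ θ d2
  ... | y1 , refl , e1 | y2 , refl , e2 = just y1 ∷ y2 , refl , djust e1 e2
  CompletesC-ren⁻¹ ρ (just t ∷ θ) (djunk j d2) with CompletesC-ren⁻¹ ρ θ d2
  ... | y2 , refl , e2 = nothing ∷ y2 , refl , djunk (Junk-ren⁻¹ ρ t j) e2

lookup-nothing-⟶C : ∀ {k} {θ θ' : Cases n k} → θ ⟶C θ' → ∀ c → lookupC θ c ≡ nothing → lookupC θ' c ≡ nothing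
lookup-nothing-⟶C (here s) zero ()
lookup-nothing-⟶C (there s) zero e = e
lookup-nothing-⟶C (here s) (suc c) e = e
lookup-nothing-⟶C (there s) (suc c) e = lookup-nothing-⟶C s c e

lookup-nothing-compC : ∀ {k} (θ : Cases n n) (φ : Cases n k) c → lookupC φ c ≡ nothing → lookupC (compC θ φ) c ≡ nothing
lookup-nothing-compC θ (nothing ∷ φ) zero e = refl
lookup-nothing-compC θ (just x ∷ φ) zero ()
lookup-nothing-compC θ (nothing ∷ φ) (suc c) e = lookup-nothing-compC θ φ c e
lookup-nothing-compC θ (just x ∷ φ) (suc c) e = lookup-nothing-compC θ φ c e

Junk-⟶ : ∀ {j j' : Term n} → Junk j → j ⟶ j' → Junk j'
Junk-⟶ (jbase e) (CaseCons e') with () ← trans (sym e) e'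
Junk-⟶ (jbase e) (caseBody ())
Junk-⟶ (jbase {c = c} e) (caseBr s) = jbase (lookup-nothing-⟶C s c e)
Junk-⟶ (jcase ()) (CaseCons _)
Junk-⟶ (jcase ()) CaseApp
Junk-⟶ (jcase ()) CaseLam
Junk-⟶ (jcase {θ} (jbase {φ} {c} e)) CaseCase = jbase (lookup-nothing-compC θ φ c e)
Junk-⟶ (jcase (jcase j)) CaseCase = jcase j
Junk-⟶ (jcase j) (caseBody s) = jcase (Junk-⟶ j s)
Junk-⟶ (jcase j) (caseBr s) = jcase j

CompletesC-compC : ∀ {k} {θ θ' : Cases n n} {φ φ' : Cases n k} → CompletesC θ θ' → CompletesC φ φ'
    → CompletesC (compC θ φ) (compC θ' φ')
CompletesC-compC dθ dnil = dnil
CompletesC-compC dθ (dnothing d) = dnothing (CompletesC-compC dθ d)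
CompletesC-compC dθ (djust a d) = djust (dcase dθ a) (CompletesC-compC dθ d)
CompletesC-compC dθ (djunk j d) = djunk (jcase j) (CompletesC-compC dθ d)

lookup-CompletesC : ∀ {k} {θ θ' : Cases n k} → CompletesC θ θ' → ∀ c {t} → lookupC θ c ≡ just t →
            (∃ λ t' → lookupC θ' c ≡ just t' × Completes t t') ⊎ lookupC θ' c ≡ nothing
lookup-CompletesC (dnothing d) zero ()
lookup-CompletesC (djust a d) zero refl = inj₁ (_ , refl , a)
lookup-CompletesC (djunk j d) zero e = inj₂ refl
lookup-CompletesC (dnothing d) (suc c) e = lookup-CompletesC d c e
lookup-CompletesC (djust a d) (suc c) e = lookup-CompletesC d c e
lookup-CompletesC (djunk j d) (suc c) e = lookup-CompletesC d c e

lookup-nothing-CompletesC : ∀ {k} {θ θ' : Cases n k} → CompletesC θ θ' → ∀ c → lookupC θ c ≡ nothing → lookupC θ' c ≡ nothing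
lookup-nothing-CompletesC (dnothing d) zero e = refl
lookup-nothing-CompletesC (djust a d) zero ()
lookup-nothing-CompletesC (djunk j d) zero ()
lookup-nothing-CompletesC (dnothing d) (suc c) e = lookup-nothing-CompletesC d c e
lookup-nothing-CompletesC (djust a d) (suc c) e = lookup-nothing-CompletesC d c e
lookup-nothing-CompletesC (djunk j d) (suc c) e = lookup-nothing-CompletesC d c e

DefinedC : ∀ {k} → Cases n k → Set
DefinedC θ = ¬ HasMatchFailureC θ

-- A CaseCons step of u never selects a junk branch: s would contain a match failure.
mutual
  Completes-simulates : ∀ {u u' s : Term n} → Completes u s → Defined s → u ⟶ u' → ∃ λ s' → s ⟶* s' × Completes u' s'
  Completes-simulates (dapp (dlam d1) d2) nd AppLam = _ , (AppLam ◅ ε) , Completes-sub (λ { zero → d2 ; (suc x) → dvar }) d1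
  Completes-simulates (dlam (dapp {t = .(weaken t)} d dvar)) nd (LamApp {t}) with Completes-ren⁻¹ suc t d
  ... | y , refl , dy = y , (LamApp ◅ ε) , dy
  Completes-simulates (dcase dθ dcon) nd (CaseCons {c = c} e) with lookup-CompletesC dθ c e
  ... | inj₁ (t' , e' , d) = t' , (CaseCons e' ◅ ε) , d
  ... | inj₂ e' = ⊥-elim (nd (here e'))
  Completes-simulates (dcase dθ (dapp d1 d2)) nd CaseApp = _ , (CaseApp ◅ ε) , dapp (dcase dθ d1) d2
  Completes-simulates (dcase dθ (dlam d)) nd CaseLam = _ , (CaseLam ◅ ε) , dlam (dcase (CompletesC-ren suc dθ) d)
  Completes-simulates (dcase dθ (dcase dφ d)) nd CaseCase = _ , (CaseCase ◅ ε) , dcase (CompletesC-compC dθ dφ) d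
  Completes-simulates (dapp d1 d2) nd (appL s) with Completes-simulates d1 (nd ∘ appL) s
  ... | s' , r , d = _ , ⟶*-appL r , dapp d d2
  Completes-simulates (dapp d1 d2) nd (appR s) with Completes-simulates d2 (nd ∘ appR) s
  ... | s' , r , d = _ , ⟶*-appR r , dapp d1 d
  Completes-simulates (dlam d1) nd (lamC s) with Completes-simulates d1 (nd ∘ lamC) s
  ... | s' , r , d = _ , ⟶*-lam r , dlam d
  Completes-simulates (dcase dθ d1) nd (caseBody s) with Completes-simulates d1 (nd ∘ caseBody) s
  ... | s' , r , d = _ , ⟶*-case ε r , dcase dθ d
  Completes-simulates (dcase dθ d1) nd (caseBr s) with CompletesC-simulates dθ (nd ∘ caseBr) s
  ... | s' , r , d = _ , ⟶*-case r ε , dcase d d1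

  CompletesC-simulates : ∀ {k} {θ θ₂ θ' : Cases n k} → CompletesC θ θ' → DefinedC θ' → θ ⟶C θ₂
      → ∃ λ θ'' → θ' ⟶C* θ'' × CompletesC θ₂ θ''
  CompletesC-simulates (djust d dθ) nd (here s) with Completes-simulates d (nd ∘ here) s
  ... | t'' , r , d' = _ , ⟶C*-just r ε , djust d' dθ
  CompletesC-simulates (djunk j dθ) nd (here s) = _ , ε , djunk (Junk-⟶ j s) dθ
  CompletesC-simulates (dnothing dθ) nd (there s) with CompletesC-simulates dθ (nd ∘ there) s
  ... | θ'' , r , d = _ , ⟶C*-nothing r , dnothing d
  CompletesC-simulates (djust a dθ) nd (there s) with CompletesC-simulates dθ (nd ∘ there) s
  ... | θ'' , r , d = _ , ⟶C*-just ε r , djust a d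
  CompletesC-simulates (djunk j dθ) nd (there s) with CompletesC-simulates dθ (nd ∘ there) s
  ... | θ'' , r , d = _ , ⟶C*-nothing r , djunk j d

Completes-Junk-failure : ∀ {j b : Term n} → Junk j → Completes j b → HasMatchFailure b
Completes-Junk-failure (jbase {c = c} e) (dcase dθ dcon) = here (lookup-nothing-CompletesC dθ c e)
Completes-Junk-failure (jcase j) (dcase dθ d) = caseBody (Completes-Junk-failure j d)

mutual
  Completes-unique : ∀ {u s₁ s₂ : Term n} → Completes u s₁ → Completes u s₂ → Defined s₁ → Defined s₂ → s₁ ≡ s₂
  Completes-unique dvar dvar n1 n2 = refl
  Completes-unique dcon dcon n1 n2 = refl
  Completes-unique (dapp a b) (dapp a' b') n1 n2 =
    cong₂ app (Completes-unique a a' (n1 ∘ appL) (n2 ∘ appL)) (Completes-unique b b' (n1 ∘ appR) (n2 ∘ appR))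
  Completes-unique (dlam a) (dlam a') n1 n2 = cong lam (Completes-unique a a' (n1 ∘ lamC) (n2 ∘ lamC))
  Completes-unique (dcase a b) (dcase a' b') n1 n2 =
    cong₂ case (CompletesC-unique a a' (n1 ∘ caseBr) (n2 ∘ caseBr)) (Completes-unique b b' (n1 ∘ caseBody) (n2 ∘ caseBody))

  CompletesC-unique : ∀ {k} {θ θ₁ θ₂ : Cases n k} → CompletesC θ θ₁ → CompletesC θ θ₂ → DefinedC θ₁ → DefinedC θ₂ → θ₁ ≡ θ₂
  CompletesC-unique dnil dnil n1 n2 = refl
  CompletesC-unique (dnothing a) (dnothing a') n1 n2 = cong (nothing ∷_) (CompletesC-unique a a' (n1 ∘ there) (n2 ∘ there))
  CompletesC-unique (djust a b) (djust a' b') n1 n2 =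
    cong₂ just∷ (Completes-unique a a' (n1 ∘ here) (n2 ∘ here)) (CompletesC-unique b b' (n1 ∘ there) (n2 ∘ there))
  CompletesC-unique (djust a b) (djunk j b') n1 n2 = ⊥-elim (n1 (here (Completes-Junk-failure j a)))
  CompletesC-unique (djunk j b) (djust a' b') n1 n2 = ⊥-elim (n2 (here (Completes-Junk-failure j a')))
  CompletesC-unique (djunk j b) (djunk j' b') n1 n2 = cong (nothing ∷_) (CompletesC-unique b b' (n1 ∘ there) (n2 ∘ there))

Completes-simulates* : ∀ {u u' s : Term n} → Completes u s → HereditarilyDefined s → u ⟶* u' → ∃ λ s' → s ⟶* s' × Completes u' s'
Completes-simulates* {s = s} d hd ε = s , ε , d
Completes-simulates* {s = s} d hd (st ◅ rest) with Completes-simulates d (hd s ε) st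
... | s₁ , r1 , d1 with Completes-simulates* d1 (λ v r → hd v (r1 ◅◅ r)) rest
...   | s₂ , r2 , d2 = s₂ , (r1 ◅◅ r2) , d2

mutual
  complete-Completes : ∀ {m} (t : Term (suc m)) → Completes (complete t) t
  complete-Completes (var x) = dvar
  complete-Completes (app t u) = dapp (complete-Completes t) (complete-Completes u)
  complete-Completes (lam t) = dlam (complete-Completes t)
  complete-Completes (con c) = dcon
  complete-Completes (case θ t) = dcase (completeC-CompletesC θ) (complete-Completes t)

  completeC-CompletesC : ∀ {m k} (θ : Cases (suc m) k) → CompletesC (completeC θ) θ
  completeC-CompletesC [] = dnil
  completeC-CompletesC (nothing ∷ θ) = djunk (jbase refl) (completeC-CompletesC θ)
  completeC-CompletesC (just t ∷ θ) = djust (complete-Completes t) (completeC-CompletesC θ)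

proposition7 : ∀ (m : ℕ) (t₁ t₂ : Term (suc m))
    → HereditarilyDefined t₁ → HereditarilyDefined t₂
    → complete t₁ ≡λC complete t₂ → t₁ ≡λC t₂
proposition7 m t₁ t₂ hd₁ hd₂ t₁≡t₂ =
  let w , r₁ , r₂ = ⟶-churchRosser t₁≡t₂
      s₁ , q₁ , c₁ = Completes-simulates* (complete-Completes t₁) hd₁ r₁
      s₂ , q₂ , c₂ = Completes-simulates* (complete-Completes t₂) hd₂ r₂
      s₁≡s₂ = Completes-unique c₁ c₂ (hd₁ s₁ q₁) (hd₂ s₂ q₂)
  in a—↠b⇒a↔b q₁ ◅◅ subst (_≡λC t₂) (sym s₁≡s₂) (a—↠b⇒b↔a q₂)
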